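{- Let $R=\{(0,0),(0,1),(0,2),(1,0),(1,1),(1,2),(2,0),(2,1),(2,2),(3,3)\}$. Then $(123,R)\sim_d(132,R)$.
   Context: $S_n$ denotes the set of permutations of $[n]=\{1,\dots,n\}$, written $\pi=\pi_1\cdots\pi_n$. A mesh pattern of length $k$ is a pair $(\tau,R)$ with $\tau\in S_k$ and $R\subseteq\{0,1,\dots,k\}^2$ (the shaded boxes; box $(a,b)$ is the unit square $[a,a+1]\times[b,b+1]$ in the diagram of $\tau$). An occurrence of $(\tau,R)$ in $\pi\in S_n$ is a choice of indices $i_1<\dots<i_k$ such that $\pi_{i_1}\cdots\pi_{i_k}$ is order-isomorphic to $\tau$ and, with $i_0=0$, $i_{k+1}=n+1$, $v_1<\dots<v_k$ the values $\pi_{i_1},\dots,\pi_{i_k}$ sorted increasingly, $v_0=0$, $v_{k+1}=n+1$, for every $(a,b)\in R$ there is no index $m$ with $i_a<m<i_{a+1}$ and $v_b<\pi_m<v_{b+1}$. Mesh patterns $p,q$ are equidistributed, $p\sim_d q$, if for all $n,\ell\ge0$ the number of $\pi\in S_n$ with exactly $\ell$ occurrences of $p$ equals the number with exactly $\ell$ occurrences of $q$. -}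

module Defs where

open import Data.Nat using (ℕ; zero; suc; _+_; _<ᵇ_; _≡ᵇ_)
open import Data.Bool using (Bool; true; false; _∧_; _∨_; not; if_then_else_)
open import Data.List using (List; []; _∷_; map; concatMap; length; filter; upTo)
open import Data.Fin using (Fin; toℕ)
open import Data.Product using (_×_; _,_; proj₁; proj₂)
open import Relation.Binary.PropositionalEquality using (_≡_)
open import Relation.Nullary.Decidable using (does)
open import Data.Bool.Properties using (T?)
open import Data.Bool using (T)

allᵇ : {A : Set} → (A → Bool) → List A → Bool
allᵇ p []       = true
allᵇ p (x ∷ xs) = p x ∧ allᵇ p xs

words : ℕ → ℕ → List (List ℕ)
words zero    k = [] ∷ []
words (suc m) k = concatMap (λ w → map (λ v → suc v ∷ w) (upTo k)) (words m k)

-- A list is a permutation of [n] iff every value 1..n occurs exactly once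
-- (together with length n and entries in 1..n, guaranteed by `words`).
count : ℕ → List ℕ → ℕ
count v []       = 0
count v (x ∷ xs) = if v ≡ᵇ x then suc (count v xs) else count v xs

isPerm : ℕ → List ℕ → Bool
isPerm n w = allᵇ (λ v → count (suc v) w ≡ᵇ 1) (upTo n)

Sym : ℕ → List (List ℕ)
Sym n = filter (λ w → T? (isPerm n w)) (words n n)

-- π_m for 1 ≤ m ≤ n (1-based); default 0 otherwise (never used out of range).
at : List ℕ → ℕ → ℕ
at []       _             = 0
at (x ∷ xs) zero          = 0
at (x ∷ xs) (suc zero)    = x
at (x ∷ xs) (suc (suc m)) = at xs (suc m)

-- Patterns of length 3: τ ∈ S_3 given as its one-line notation (1-based),
-- shading R a list of boxes (a , b) with a, b ∈ {0,…,3}.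
record MeshPattern3 : Set where
  constructor mesh
  field
    τ₁ τ₂ τ₃ : ℕ
    shading  : List (ℕ × ℕ)

_<ᵇ'_ : ℕ → ℕ → Bool
a <ᵇ' b = a <ᵇ b

orderIso : ℕ → ℕ → ℕ → ℕ → ℕ → ℕ → Bool
orderIso x y z a b c =
  ((x <ᵇ y) ≡ᵇ' (a <ᵇ b)) ∧ ((x <ᵇ z) ≡ᵇ' (a <ᵇ c)) ∧ ((y <ᵇ z) ≡ᵇ' (b <ᵇ c))
  where
  _≡ᵇ'_ : Bool → Bool → Bool
  true  ≡ᵇ' q = q
  false ≡ᵇ' q = not q

min3 max3 mid3 : ℕ → ℕ → ℕ → ℕ
min3 x y z = if x <ᵇ y then (if x <ᵇ z then x else z) else (if y <ᵇ z then y else z)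
max3 x y z = if y <ᵇ x then (if z <ᵇ x then x else z) else (if z <ᵇ y then y else z)
mid3 x y z = (x + y + z) Data.Nat.∸ (min3 x y z + max3 x y z)

boxEmpty : List ℕ → ℕ → ℕ → ℕ → ℕ → Bool
boxEmpty π lo hi vlo vhi =
  allᵇ (λ m → not ((lo <ᵇ m) ∧ (m <ᵇ hi) ∧ (vlo <ᵇ at π m) ∧ (at π m <ᵇ vhi)))
      (map suc (upTo (length π)))

pick : ℕ → ℕ → ℕ → ℕ → ℕ → ℕ → ℕ
pick zero          a b c d e = a
pick (suc zero)    a b c d e = b
pick (suc (suc zero)) a b c d e = c
pick (suc (suc (suc zero))) a b c d e = d
pick _             a b c d e = e

isOcc : MeshPattern3 → List ℕ → ℕ → ℕ → ℕ → Bool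
isOcc (mesh a b c R) π i₁ i₂ i₃ =
  orderIso x y z a b c ∧
  allᵇ (λ box → boxEmpty π (I (proj₁ box)) (I (suc (proj₁ box)))
                          (V (proj₂ box)) (V (suc (proj₂ box)))) R
  where
  n = length π
  x = at π i₁
  y = at π i₂
  z = at π i₃
  I : ℕ → ℕ
  I k = pick k 0 i₁ i₂ i₃ (suc n)
  V : ℕ → ℕ
  V k = pick k 0 (min3 x y z) (mid3 x y z) (max3 x y z) (suc n)

occ : MeshPattern3 → List ℕ → ℕ
occ p π =
  length (filter (λ t → T? (isOcc p π (proj₁ t) (proj₁ (proj₂ t)) (proj₂ (proj₂ t))))
    (concatMap (λ i → concatMap (λ j → concatMap (λ k →
        if (i <ᵇ j) ∧ (j <ᵇ k) then (i , j , k) ∷ [] else [])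
      idx) idx) idx))
  where
  idx = map suc (upTo (length π))

numWith : MeshPattern3 → ℕ → ℕ → ℕ
numWith p n ℓ = length (filter (λ π → T? (occ p π ≡ᵇ ℓ)) (Sym n))

_∼d_ : MeshPattern3 → MeshPattern3 → Set
p ∼d q = ∀ n ℓ → numWith p n ℓ ≡ numWith q n ℓ

R₀ : List (ℕ × ℕ)
R₀ = (0 , 0) ∷ (0 , 1) ∷ (0 , 2) ∷ (1 , 0) ∷ (1 , 1) ∷ (1 , 2)
   ∷ (2 , 0) ∷ (2 , 1) ∷ (2 , 2) ∷ (3 , 3) ∷ []

-- Every permutation of [n] arises from one of [n - 1] by inserting the maximum
-- n at some position q. With R shaded, the region left of the last entry of an
-- occurrence and below its largest value contains nothing but the occurrence,
-- and nothing lies right of and above it. Hence the inserted maximum destroys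
-- exactly the old occurrences ending before q, and creates one new occurrence,
-- at positions 1, 2, 3, precisely when q = 3 for 123, resp. q = 2 for 132, and
-- the old permutation starts with an ascent. Old occurrences all end at
-- position 3 or later, so they cannot tell q = 2 from q = 3. The map φ that
-- recursively reinserts the maximum at the same position, exchanging 2 and 3
-- whenever the recursively transformed rest starts with an ascent, is therefore
-- an involution of S_n carrying occurrences of (123, R) to those of (132, R).
{-# OPTIONS --safe #-}
module Submission where

open import Defs

open import Algebra.Bundles using (CommutativeMonoid)
import Algebra.Properties.CommutativeSemigroup as CommutativeSemigroupProperties
open import Data.Bool using (Bool; true; false; _∧_; not; if_then_else_)
open import Data.Bool.Properties using (T?; T-≡; not-injective; ∧-zeroʳ; ∧-identityʳ; ∧-assoc; ∧-commutativeMonoid)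
open import Data.Empty using (⊥-elim)
open import Data.List using (List; []; _∷_; map; concatMap; length; filter; upTo; applyUpTo; _++_)
open import Data.List.Properties using (length-++; filter-++; ∷-injectiveˡ; ∷-injectiveʳ)
open import Data.List.Membership.Propositional using (_∈_; find; lose)
open import Data.List.Membership.Propositional.Properties
  using (∈-map⁺; ∈-map⁻; ∈-concatMap⁺; ∈-concatMap⁻; ∈-upTo⁺; ∈-upTo⁻; ∈-filter⁺; ∈-filter⁻)
open import Data.List.Membership.Propositional.Properties.WithK using (unique∧set⇒bag)
open import Data.List.Relation.Binary.BagAndSetEquality using (∼bag⇒↭)
open import Data.List.Relation.Binary.Disjoint.Propositional using (Disjoint)
open import Data.List.Relation.Binary.Permutation.Propositional using (_↭_)
open import Data.List.Relation.Binary.Permutation.Propositional.Properties using (↭-length; filter-↭)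
open import Data.List.Relation.Unary.All as All using (All; []; _∷_)
import Data.List.Relation.Unary.All.Properties as AllP
import Data.List.Relation.Unary.AllPairs as AllPairs
import Data.List.Relation.Unary.AllPairs.Properties as AllPairsP
open import Data.List.Relation.Unary.Any using (here; there)
open import Data.List.Relation.Unary.Unique.Propositional using (Unique)
import Data.List.Relation.Unary.Unique.Propositional.Properties as UniqueP
open import Data.Nat
open import Data.Nat.Properties
open import Data.Product using (Σ; _×_; _,_; proj₁; proj₂)
open import Function using (_∘_)
open import Function.Bundles using (Equivalence; mk⇔)
open import Relation.Binary using (tri<; tri≈; tri>)
open import Relation.Binary.PropositionalEquality
open import Relation.Nullary using (¬_; yes; no)

open CommutativeSemigroupProperties +-commutativeSemigroup
  using () renaming (interchange to +-interchange; x∙yz≈y∙xz to +-leftSwap)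
open CommutativeSemigroupProperties (CommutativeMonoid.commutativeSemigroup ∧-commutativeMonoid)
  using () renaming (x∙yz≈y∙xz to ∧-leftSwap)

𝟙 : Bool → ℕ
𝟙 true  = 1
𝟙 false = 0

<⇒<ᵇ≡true : ∀ {m n} → m < n → (m <ᵇ n) ≡ true
<⇒<ᵇ≡true {zero}  {suc n} _         = refl
<⇒<ᵇ≡true {suc m} {suc n} (s≤s m<n) = <⇒<ᵇ≡true m<n

≥⇒<ᵇ≡false : ∀ {m n} → n ≤ m → (m <ᵇ n) ≡ false
≥⇒<ᵇ≡false {m}     {zero}  _         = refl
≥⇒<ᵇ≡false {suc m} {suc n} (s≤s n≤m) = ≥⇒<ᵇ≡false n≤m

<ᵇ≡true⇒< : ∀ {m n} → (m <ᵇ n) ≡ true → m < n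
<ᵇ≡true⇒< {zero}  {suc n} _ = s≤s z≤n
<ᵇ≡true⇒< {suc m} {suc n} e = s≤s (<ᵇ≡true⇒< e)

<ᵇ≡false⇒≥ : ∀ {m n} → (m <ᵇ n) ≡ false → n ≤ m
<ᵇ≡false⇒≥ {m}     {zero}  _ = z≤n
<ᵇ≡false⇒≥ {suc m} {suc n} e = s≤s (<ᵇ≡false⇒≥ e)

≡⇒≡ᵇ≡true : ∀ {m n} → m ≡ n → (m ≡ᵇ n) ≡ true
≡⇒≡ᵇ≡true {zero}  refl = refl
≡⇒≡ᵇ≡true {suc m} refl = ≡⇒≡ᵇ≡true {m} refl

≢⇒≡ᵇ≡false : ∀ {m n} → m ≢ n → (m ≡ᵇ n) ≡ false
≢⇒≡ᵇ≡false {zero}  {zero}  m≢n = ⊥-elim (m≢n refl)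
≢⇒≡ᵇ≡false {zero}  {suc n} _   = refl
≢⇒≡ᵇ≡false {suc m} {zero}  _   = refl
≢⇒≡ᵇ≡false {suc m} {suc n} m≢n = ≢⇒≡ᵇ≡false (m≢n ∘ cong suc)

≡ᵇ≡true⇒≡ : ∀ {m n} → (m ≡ᵇ n) ≡ true → m ≡ n
≡ᵇ≡true⇒≡ {zero}  {zero}  _ = refl
≡ᵇ≡true⇒≡ {suc m} {suc n} e = cong suc (≡ᵇ≡true⇒≡ e)

≡ᵇ≡false⇒≢ : ∀ {m n} → (m ≡ᵇ n) ≡ false → m ≢ n
≡ᵇ≡false⇒≢ {suc m} {suc n} e refl = ≡ᵇ≡false⇒≢ {m} e refl

sumBelow : ℕ → (ℕ → ℕ) → ℕ
sumBelow zero    f = 0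
sumBelow (suc n) f = f 0 + sumBelow n (f ∘ suc)

allBelow : ℕ → (ℕ → Bool) → Bool
allBelow zero    f = true
allBelow (suc n) f = f 0 ∧ allBelow n (f ∘ suc)

sumBelow-cong : ∀ n {f g : ℕ → ℕ} → (∀ m → m < n → f m ≡ g m) → sumBelow n f ≡ sumBelow n g
sumBelow-cong zero    f≗g = refl
sumBelow-cong (suc n) f≗g = cong₂ _+_ (f≗g 0 z<s) (sumBelow-cong n (λ m m<n → f≗g (suc m) (s≤s m<n)))

allBelow-cong : ∀ n {f g : ℕ → Bool} → (∀ m → m < n → f m ≡ g m) → allBelow n f ≡ allBelow n g
allBelow-cong zero    f≗g = refl
allBelow-cong (suc n) f≗g = cong₂ _∧_ (f≗g 0 z<s) (allBelow-cong n (λ m m<n → f≗g (suc m) (s≤s m<n)))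

sumBelow-+ : ∀ n (f g : ℕ → ℕ) → sumBelow n (λ m → f m + g m) ≡ sumBelow n f + sumBelow n g
sumBelow-+ zero    f g = refl
sumBelow-+ (suc n) f g =
  trans (cong (f 0 + g 0 +_) (sumBelow-+ n (f ∘ suc) (g ∘ suc))) (+-interchange (f 0) (g 0) _ _)

sumBelow-zero : ∀ n (f : ℕ → ℕ) → (∀ m → m < n → f m ≡ 0) → sumBelow n f ≡ 0
sumBelow-zero zero    f f≗0 = refl
sumBelow-zero (suc n) f f≗0 =
  cong₂ _+_ (f≗0 0 z<s) (sumBelow-zero n (f ∘ suc) (λ m m<n → f≗0 (suc m) (s≤s m<n)))

sumBelow-single : ∀ n (f : ℕ → ℕ) m₀ → m₀ < n → (∀ m → m < n → m ≢ m₀ → f m ≡ 0) →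
  sumBelow n f ≡ f m₀
sumBelow-single (suc n) f zero _ f≗0 =
  trans (cong (f 0 +_) (sumBelow-zero n (f ∘ suc) (λ m m<n → f≗0 (suc m) (s≤s m<n) λ ()))) (+-identityʳ _)
sumBelow-single (suc n) f (suc m₀) (s≤s m₀<n) f≗0 =
  cong₂ _+_ (f≗0 0 z<s λ ())
        (sumBelow-single n (f ∘ suc) m₀ m₀<n (λ m m<n m≢m₀ → f≗0 (suc m) (s≤s m<n) (m≢m₀ ∘ suc-injective)))

allBelow-true : ∀ n (f : ℕ → Bool) → (∀ m → m < n → f m ≡ true) → allBelow n f ≡ true
allBelow-true zero    f f≗true = refl
allBelow-true (suc n) f f≗true rewrite f≗true 0 z<s = allBelow-true n (f ∘ suc) (λ m m<n → f≗true (suc m) (s≤s m<n))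

allBelow-false : ∀ n (f : ℕ → Bool) m → m < n → f m ≡ false → allBelow n f ≡ false
allBelow-false (suc n) f zero    _         fm≡false rewrite fm≡false = refl
allBelow-false (suc n) f (suc m) (s≤s m<n) fm≡false =
  trans (cong (f 0 ∧_) (allBelow-false n (f ∘ suc) m m<n fm≡false)) (∧-zeroʳ (f 0))

allBelow-elim : ∀ n (f : ℕ → Bool) → allBelow n f ≡ true → ∀ m → m < n → f m ≡ true
allBelow-elim (suc n) f all≡true zero    _ with f 0
... | true = refl
allBelow-elim (suc n) f all≡true (suc m) (s≤s m<n) with f 0
... | true = allBelow-elim n (f ∘ suc) all≡true m m<n

punchIn : ℕ → ℕ → ℕ
punchIn q m = if m <ᵇ q then m else suc m

punchIn-suc : ∀ q m → punchIn (suc q) (suc m) ≡ suc (punchIn q m)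
punchIn-suc q m with m <ᵇ q
... | true  = refl
... | false = refl

punchIn-< : ∀ q m → m < q → punchIn q m ≡ m
punchIn-< q m m<q rewrite <⇒<ᵇ≡true m<q = refl

punchIn-<ᵇ : ∀ q a b → (punchIn q a <ᵇ punchIn q b) ≡ (a <ᵇ b)
punchIn-<ᵇ q a b with a <? q | b <? q
... | yes a<q | yes b<q rewrite <⇒<ᵇ≡true a<q | <⇒<ᵇ≡true b<q = refl
... | yes a<q | no b≮q rewrite <⇒<ᵇ≡true a<q | ≥⇒<ᵇ≡false (≮⇒≥ b≮q) =
  trans (<⇒<ᵇ≡true (m<n⇒m<1+n a<b)) (sym (<⇒<ᵇ≡true a<b))
  where
  a<b : a < b
  a<b = <-≤-trans a<q (≮⇒≥ b≮q)
... | no a≮q | yes b<q rewrite ≥⇒<ᵇ≡false (≮⇒≥ a≮q) | <⇒<ᵇ≡true b<q =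
  trans (≥⇒<ᵇ≡false (m≤n⇒m≤1+n b≤a)) (sym (≥⇒<ᵇ≡false b≤a))
  where
  b≤a : b ≤ a
  b≤a = ≤-trans (<⇒≤ b<q) (≮⇒≥ a≮q)
... | no a≮q | no b≮q rewrite ≥⇒<ᵇ≡false (≮⇒≥ a≮q) | ≥⇒<ᵇ≡false (≮⇒≥ b≮q) = refl

punchIn-<ᵇ-pivot : ∀ q m → (punchIn q m <ᵇ q) ≡ (m <ᵇ q)
punchIn-<ᵇ-pivot q m with m <? q
... | yes m<q rewrite <⇒<ᵇ≡true m<q = <⇒<ᵇ≡true m<q
... | no m≮q rewrite ≥⇒<ᵇ≡false (≮⇒≥ m≮q) = ≥⇒<ᵇ≡false (m≤n⇒m≤1+n (≮⇒≥ m≮q))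

sumBelow-punchIn : ∀ n q (f : ℕ → ℕ) → q ≤ n → sumBelow (suc n) f ≡ f q + sumBelow n (f ∘ punchIn q)
sumBelow-punchIn n       zero    f _ = refl
sumBelow-punchIn (suc n) (suc q) f (s≤s q≤n) = begin
  f 0 + sumBelow (suc n) (f ∘ suc)                        ≡⟨ cong (f 0 +_) (sumBelow-punchIn n q (f ∘ suc) q≤n) ⟩
  f 0 + (f (suc q) + sumBelow n (f ∘ suc ∘ punchIn q))    ≡⟨ +-leftSwap (f 0) (f (suc q)) _ ⟩
  f (suc q) + (f 0 + sumBelow n (f ∘ suc ∘ punchIn q))
    ≡⟨ cong (λ t → f (suc q) + (f 0 + t)) (sumBelow-cong n (λ m _ → cong f (sym (punchIn-suc q m)))) ⟩
  f (suc q) + sumBelow (suc n) (f ∘ punchIn (suc q))      ∎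
  where open ≡-Reasoning

allBelow-punchIn : ∀ n q (f : ℕ → Bool) → q ≤ n → allBelow (suc n) f ≡ f q ∧ allBelow n (f ∘ punchIn q)
allBelow-punchIn n       zero    f _ = refl
allBelow-punchIn (suc n) (suc q) f (s≤s q≤n) =
  trans (cong (f 0 ∧_) (allBelow-punchIn n q (f ∘ suc) q≤n))
  (trans (∧-leftSwap (f 0) (f (suc q)) _)
         (cong (λ t → f (suc q) ∧ (f 0 ∧ t)) (allBelow-cong n (λ m _ → cong f (sym (punchIn-suc q m))))))

countᵇ : {A : Set} → (A → Bool) → List A → ℕ
countᵇ f xs = length (filter (λ x → T? (f x)) xs)

countᵇ-∷ : {A : Set} (f : A → Bool) → ∀ x xs → countᵇ f (x ∷ xs) ≡ 𝟙 (f x) + countᵇ f xs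
countᵇ-∷ f x xs with f x
... | true  = refl
... | false = refl

countᵇ-++ : {A : Set} (f : A → Bool) → ∀ xs ys → countᵇ f (xs ++ ys) ≡ countᵇ f xs + countᵇ f ys
countᵇ-++ f xs ys = trans (cong length (filter-++ (λ x → T? (f x)) xs ys)) (length-++ (filter (λ x → T? (f x)) xs))

countᵇ-concatMap-positions : {A : Set} (f : A → Bool) (g : ℕ → List A) (h : ℕ → ℕ) → ∀ n →
  countᵇ f (concatMap g (map suc (applyUpTo h n))) ≡ sumBelow n (λ m → countᵇ f (g (suc (h m))))
countᵇ-concatMap-positions f g h zero    = refl
countᵇ-concatMap-positions f g h (suc n) =
  trans (countᵇ-++ f (g (suc (h 0))) _) (cong (countᵇ f (g (suc (h 0))) +_) (countᵇ-concatMap-positions f g (h ∘ suc) n))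

countᵇ-singleton-if : {A : Set} (f : A → Bool) → ∀ c (x : A) →
  countᵇ f (if c then x ∷ [] else []) ≡ 𝟙 (c ∧ f x)
countᵇ-singleton-if f true  x = trans (countᵇ-∷ f x []) (+-identityʳ _)
countᵇ-singleton-if f false x = refl

countᵇ-map : {A B : Set} (g : B → Bool) (f : A → B) (xs : List A) → countᵇ g (map f xs) ≡ countᵇ (g ∘ f) xs
countᵇ-map g f []       = refl
countᵇ-map g f (x ∷ xs) =
  trans (countᵇ-∷ g (f x) (map f xs))
    (trans (cong (𝟙 (g (f x)) +_) (countᵇ-map g f xs)) (sym (countᵇ-∷ (g ∘ f) x xs)))

countᵇ-cong∈ : {A : Set} (g h : A → Bool) (xs : List A) → (∀ {x} → x ∈ xs → g x ≡ h x) →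
  countᵇ g xs ≡ countᵇ h xs
countᵇ-cong∈ g h []       _   = refl
countᵇ-cong∈ g h (x ∷ xs) g≗h =
  trans (countᵇ-∷ g x xs)
    (trans (cong₂ (λ b c → 𝟙 b + c) (g≗h (here refl)) (countᵇ-cong∈ g h xs (g≗h ∘ there)))
           (sym (countᵇ-∷ h x xs)))

countᵇ-↭ : {A : Set} (g : A → Bool) {xs ys : List A} → xs ↭ ys → countᵇ g xs ≡ countᵇ g ys
countᵇ-↭ g xs↭ys = ↭-length (filter-↭ (λ x → T? (g x)) xs↭ys)

allᵇ-applyUpTo : (f : ℕ → Bool) (h : ℕ → ℕ) → ∀ n → allᵇ f (applyUpTo h n) ≡ allBelow n (f ∘ h)
allᵇ-applyUpTo f h zero    = refl
allᵇ-applyUpTo f h (suc n) = cong (f (h 0) ∧_) (allᵇ-applyUpTo f (h ∘ suc) n)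

allᵇ-positions : (f : ℕ → Bool) (h : ℕ → ℕ) → ∀ n →
  allᵇ f (map suc (applyUpTo h n)) ≡ allBelow n (λ m → f (suc (h m)))
allᵇ-positions f h zero    = refl
allᵇ-positions f h (suc n) = cong (f (suc (h 0)) ∧_) (allᵇ-positions f (h ∘ suc) n)

allᵇ-cong : {A : Set} {f g : A → Bool} (xs : List A) → (∀ x → f x ≡ g x) → allᵇ f xs ≡ allᵇ g xs
allᵇ-cong []       f≗g = refl
allᵇ-cong (x ∷ xs) f≗g = cong₂ _∧_ (f≗g x) (allᵇ-cong xs f≗g)

allᵇ-∧ : {A : Set} (f g : A → Bool) (xs : List A) → allᵇ (λ x → f x ∧ g x) xs ≡ allᵇ f xs ∧ allᵇ g xs
allᵇ-∧ f g []       = refl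
allᵇ-∧ f g (x ∷ xs) rewrite allᵇ-∧ f g xs with f x | g x
... | true  | true  = refl
... | true  | false = sym (∧-zeroʳ _)
... | false | _     = refl

allᵇ-true : {A : Set} (f : A → Bool) (xs : List A) → (∀ x → f x ≡ true) → allᵇ f xs ≡ true
allᵇ-true f []       f≗true = refl
allᵇ-true f (x ∷ xs) f≗true rewrite f≗true x = allᵇ-true f xs f≗true

allᵇ-false : {A : Set} (f : A → Bool) {x : A} (xs : List A) → x ∈ xs → f x ≡ false → allᵇ f xs ≡ false
allᵇ-false f (x ∷ xs) (here refl) fx≡false rewrite fx≡false = refl
allᵇ-false f (y ∷ xs) (there x∈)  fx≡false = trans (cong (f y ∧_) (allᵇ-false f xs x∈ fx≡false)) (∧-zeroʳ (f y))

insertAt : List ℕ → ℕ → ℕ → List ℕ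
insertAt xs       zero          v = v ∷ xs
insertAt xs       (suc zero)    v = v ∷ xs
insertAt []       (suc (suc q)) v = v ∷ []
insertAt (x ∷ xs) (suc (suc q)) v = x ∷ insertAt xs (suc q) v

length-insertAt : ∀ xs q v → length (insertAt xs q v) ≡ suc (length xs)
length-insertAt xs       zero          v = refl
length-insertAt xs       (suc zero)    v = refl
length-insertAt []       (suc (suc q)) v = refl
length-insertAt (x ∷ xs) (suc (suc q)) v = cong suc (length-insertAt xs (suc q) v)

at-0 : ∀ xs → at xs 0 ≡ 0
at-0 []       = refl
at-0 (x ∷ xs) = refl

at-beyond : ∀ xs m → length xs < m → at xs m ≡ 0
at-beyond []       m             _         = refl
at-beyond (x ∷ xs) (suc (suc m)) (s≤s lt) = at-beyond xs (suc m) lt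

at-insertAt : ∀ xs q v → 1 ≤ q → q ≤ suc (length xs) → at (insertAt xs q v) q ≡ v
at-insertAt xs       (suc zero)    v _ _          = refl
at-insertAt (x ∷ xs) (suc (suc q)) v _ (s≤s q≤) = at-insertAt xs (suc q) v (s≤s z≤n) q≤

at-insertAt-punchIn : ∀ xs q v → 1 ≤ q → q ≤ suc (length xs) → ∀ m → at (insertAt xs q v) (punchIn q m) ≡ at xs m
at-insertAt-punchIn xs       (suc zero)    v _ _ zero    = sym (at-0 xs)
at-insertAt-punchIn xs       (suc zero)    v _ _ (suc m) = refl
at-insertAt-punchIn []       (suc (suc q)) v _ (s≤s ()) m
at-insertAt-punchIn (x ∷ xs) (suc (suc q)) v _ _ zero          = refl
at-insertAt-punchIn (x ∷ xs) (suc (suc q)) v _ _ (suc zero)    = refl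
at-insertAt-punchIn (x ∷ xs) (suc (suc q)) v _ (s≤s q≤) (suc (suc m))
  rewrite punchIn-suc (suc q) (suc m) | punchIn-suc q m =
  trans (cong (at (insertAt xs (suc q) v)) (sym (punchIn-suc q m)))
        (at-insertAt-punchIn xs (suc q) v (s≤s z≤n) q≤ (suc m))

count-insertAt : ∀ v xs q w → count v (insertAt xs q w) ≡ count v (w ∷ xs)
count-insertAt v xs       zero          w = refl
count-insertAt v xs       (suc zero)    w = refl
count-insertAt v []       (suc (suc q)) w = refl
count-insertAt v (x ∷ xs) (suc (suc q)) w rewrite count-insertAt v xs (suc q) w with v ≡ᵇ x | v ≡ᵇ w
... | true  | true  = refl
... | true  | false = refl
... | false | true  = refl
... | false | false = refl

All-insertAt : ∀ {P : ℕ → Set} xs q w → P w → All P xs → All P (insertAt xs q w)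
All-insertAt xs       zero          w pw all = pw ∷ all
All-insertAt xs       (suc zero)    w pw all = pw ∷ all
All-insertAt []       (suc (suc q)) w pw all = pw ∷ []
All-insertAt (x ∷ xs) (suc (suc q)) w pw (px ∷ all) = px ∷ All-insertAt xs (suc q) w pw all

count-above : ∀ n xs → All (_≤ n) xs → count (suc n) xs ≡ 0
count-above n []       _          = refl
count-above n (x ∷ xs) (x≤n ∷ all)
  rewrite ≢⇒≡ᵇ≡false {suc n} {x} (λ e → 1+n≰n (subst (_≤ n) (sym e) x≤n)) = count-above n xs all

count≡0⇒All≢ : ∀ v xs → count v xs ≡ 0 → All (v ≢_) xs
count≡0⇒All≢ v []       _ = []
count≡0⇒All≢ v (x ∷ xs) c≡0 with v ≡ᵇ x in v≡ᵇx
... | false = ≡ᵇ≡false⇒≢ v≡ᵇx ∷ count≡0⇒All≢ v xs c≡0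

count-mono : ∀ v x xs → count v xs ≤ count v (x ∷ xs)
count-mono v x xs with v ≡ᵇ x
... | true  = n≤1+n _
... | false = ≤-refl

count-at : ∀ xs m → 1 ≤ m → m ≤ length xs → 1 ≤ count (at xs m) xs
count-at (x ∷ xs) (suc zero)    _ _ rewrite ≡⇒≡ᵇ≡true {x} refl = s≤s z≤n
count-at (x ∷ xs) (suc (suc m)) _ (s≤s m≤) = ≤-trans (count-at xs (suc m) (s≤s z≤n) m≤) (count-mono _ x xs)

count-at-twice : ∀ xs m m' → 1 ≤ m → m < m' → m' ≤ length xs → at xs m ≡ at xs m' → 2 ≤ count (at xs m) xs
count-at-twice (x ∷ xs) (suc zero) (suc zero) _ (s≤s ()) _ _
count-at-twice (x ∷ xs) (suc zero) (suc (suc m')) _ _ (s≤s m'≤) x≡ rewrite ≡⇒≡ᵇ≡true {x} refl =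
  s≤s (subst (λ v → 1 ≤ count v xs) (sym x≡) (count-at xs (suc m') (s≤s z≤n) m'≤))
count-at-twice (x ∷ xs) (suc (suc m)) (suc (suc m')) _ (s≤s m<m') (s≤s m'≤) e =
  ≤-trans (count-at-twice xs (suc m) (suc m') (s≤s z≤n) m<m' m'≤ e) (count-mono _ x xs)

at-All : ∀ {P : ℕ → Set} xs m → All P xs → 1 ≤ m → m ≤ length xs → P (at xs m)
at-All (x ∷ xs) (suc zero)    (px ∷ _)   _ _ = px
at-All (x ∷ xs) (suc (suc m)) (_ ∷ all) _ (s≤s m≤) = at-All xs (suc m) all (s≤s z≤n) m≤

at-≤ : ∀ n xs → All (λ v → 1 ≤ v × v ≤ n) xs → ∀ m → at xs m ≤ n
at-≤ n []       _          m             = z≤n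
at-≤ n (x ∷ xs) _          zero          = z≤n
at-≤ n (x ∷ xs) (px ∷ _)   (suc zero)    = proj₂ px
at-≤ n (x ∷ xs) (_ ∷ all)  (suc (suc m)) = at-≤ n xs all (suc m)

at-positive⇒inRange : ∀ xs m → 1 ≤ at xs m → 1 ≤ m × m ≤ length xs
at-positive⇒inRange xs zero 1≤ rewrite at-0 xs = ⊥-elim (1+n≰n 1≤)
at-positive⇒inRange xs (suc m) 1≤ with suc m ≤? length xs
... | yes m≤ = s≤s z≤n , m≤
... | no m≰ rewrite at-beyond xs (suc m) (≰⇒> m≰) = ⊥-elim (1+n≰n 1≤)

count-isPerm : ∀ n π → isPerm n π ≡ true → ∀ v → 1 ≤ v → v ≤ n → count v π ≡ 1
count-isPerm n π isPerm≡true (suc v) _ v<n =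
  ≡ᵇ≡true⇒≡ (allBelow-elim n _ (trans (sym (allᵇ-applyUpTo _ (λ v → v) n)) isPerm≡true) v v<n)

isPerm-intro : ∀ n π → (∀ v → 1 ≤ v → v ≤ n → count v π ≡ 1) → isPerm n π ≡ true
isPerm-intro n π counts≡1 =
  trans (allᵇ-applyUpTo _ (λ v → v) n)
        (allBelow-true n _ (λ v v<n → ≡⇒≡ᵇ≡true (counts≡1 (suc v) (s≤s z≤n) v<n)))

remove : ℕ → List ℕ → List ℕ
remove v []       = []
remove v (x ∷ xs) = if v ≡ᵇ x then xs else x ∷ remove v xs

indexOf : ℕ → List ℕ → ℕ
indexOf v []       = 0
indexOf v (x ∷ xs) = if v ≡ᵇ x then 0 else suc (indexOf v xs)

insertAt-remove : ∀ v xs → 1 ≤ count v xs → insertAt (remove v xs) (suc (indexOf v xs)) v ≡ xs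
insertAt-remove v (x ∷ xs) v∈ with v ≡ᵇ x in v≡ᵇx
... | true  = cong (_∷ xs) (≡ᵇ≡true⇒≡ v≡ᵇx)
... | false = cong (x ∷_) (insertAt-remove v xs v∈)

indexOf-< : ∀ v xs → 1 ≤ count v xs → indexOf v xs < length xs
indexOf-< v (x ∷ xs) v∈ with v ≡ᵇ x
... | true  = s≤s z≤n
... | false = s≤s (indexOf-< v xs v∈)

remove-insertAt : ∀ v xs q → count v xs ≡ 0 → 1 ≤ q → q ≤ suc (length xs) → remove v (insertAt xs q v) ≡ xs
remove-insertAt v xs       (suc zero)    _ _ _ rewrite ≡⇒≡ᵇ≡true {v} refl = refl
remove-insertAt v (x ∷ xs) (suc (suc q)) v∉ _ (s≤s q≤) with v ≡ᵇ x
... | false = cong (x ∷_) (remove-insertAt v xs (suc q) v∉ (s≤s z≤n) q≤)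

indexOf-insertAt : ∀ v xs q → count v xs ≡ 0 → 1 ≤ q → q ≤ suc (length xs) → suc (indexOf v (insertAt xs q v)) ≡ q
indexOf-insertAt v xs       (suc zero)    _ _ _ rewrite ≡⇒≡ᵇ≡true {v} refl = refl
indexOf-insertAt v (x ∷ xs) (suc (suc q)) v∉ _ (s≤s q≤) with v ≡ᵇ x
... | false = cong suc (indexOf-insertAt v xs (suc q) v∉ (s≤s z≤n) q≤)

count-remove-≢ : ∀ u v xs → u ≢ v → count u (remove v xs) ≡ count u xs
count-remove-≢ u v []       _   = refl
count-remove-≢ u v (x ∷ xs) u≢v with v ≡ᵇ x in v≡ᵇx
... | true rewrite ≢⇒≡ᵇ≡false {u} {x} (λ u≡x → u≢v (trans u≡x (sym (≡ᵇ≡true⇒≡ v≡ᵇx)))) = refl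
... | false with u ≡ᵇ x
...   | true  = cong suc (count-remove-≢ u v xs u≢v)
...   | false = count-remove-≢ u v xs u≢v

count-remove : ∀ v xs → 1 ≤ count v xs → suc (count v (remove v xs)) ≡ count v xs
count-remove v (x ∷ xs) v∈ with v ≡ᵇ x in v≡ᵇx
... | true  = refl
... | false rewrite v≡ᵇx = count-remove v xs v∈

All-remove : ∀ {P : ℕ → Set} v xs → All P xs → All P (remove v xs)
All-remove v []       all        = all
All-remove v (x ∷ xs) (px ∷ all) with v ≡ᵇ x
... | true  = all
... | false = px ∷ All-remove v xs all

length-remove : ∀ v xs → 1 ≤ count v xs → suc (length (remove v xs)) ≡ length xs
length-remove v (x ∷ xs) v∈ with v ≡ᵇ x
... | true  = refl
... | false = cong suc (length-remove v xs v∈)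

record Perm (n : ℕ) (π : List ℕ) : Set where
  field
    length≡ : length π ≡ n
    inRange : All (λ v → 1 ≤ v × v ≤ n) π
    isPerm≡true : isPerm n π ≡ true

  at≤ : ∀ m → at π m ≤ n
  at≤ = at-≤ n π inRange

  at-positive : ∀ m → 1 ≤ m → m ≤ n → 1 ≤ at π m
  at-positive m 1≤m m≤n = proj₁ (at-All π m inRange 1≤m (subst (m ≤_) (sym length≡) m≤n))

  private
    at-injective< : ∀ m m' → m < m' → 1 ≤ at π m → at π m ≢ at π m'
    at-injective< m m' m<m' 1≤πm πm≡πm' =
      1+n≰n (subst (2 ≤_) (count-isPerm n π isPerm≡true (at π m) 1≤πm (at≤ m))
                   (count-at-twice π m m' (proj₁ (at-positive⇒inRange π m 1≤πm)) m<m'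
                                   (proj₂ (at-positive⇒inRange π m' (subst (1 ≤_) πm≡πm' 1≤πm))) πm≡πm'))

  at-injective : ∀ m m' → 1 ≤ at π m → at π m ≡ at π m' → m ≡ m'
  at-injective m m' 1≤πm πm≡πm' with <-cmp m m'
  ... | tri< m<m' _ _ = ⊥-elim (at-injective< m m' m<m' 1≤πm πm≡πm')
  ... | tri≈ _ m≡m' _ = m≡m'
  ... | tri> _ _ m'<m = ⊥-elim (at-injective< m' m m'<m (subst (1 ≤_) πm≡πm' 1≤πm) (sym πm≡πm'))

  position≤ : ∀ {q} → q ≤ suc n → q ≤ suc (length π)
  position≤ {q} = subst (λ L → q ≤ suc L) (sym length≡)

  count-above-max : count (suc n) π ≡ 0
  count-above-max = count-above n π (All.map proj₂ inRange)

Perm-insertMax : ∀ {n π'} q → Perm n π' → 1 ≤ q → q ≤ suc n → Perm (suc n) (insertAt π' q (suc n))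
Perm-insertMax {n} {π'} q P 1≤q q≤ = record
  { length≡     = trans (length-insertAt π' q (suc n)) (cong suc length≡)
  ; inRange     = All-insertAt π' q (suc n) (s≤s z≤n , ≤-refl)
                    (All.map (λ (1≤v , v≤n) → 1≤v , m≤n⇒m≤1+n v≤n) inRange)
  ; isPerm≡true = isPerm-intro (suc n) (insertAt π' q (suc n)) counts≡1
  }
  where
  open Perm P
  counts≡1 : ∀ v → 1 ≤ v → v ≤ suc n → count v (insertAt π' q (suc n)) ≡ 1
  counts≡1 v 1≤v v≤ rewrite count-insertAt v π' q (suc n) with v ≟ suc n
  ... | yes refl rewrite ≡⇒≡ᵇ≡true {suc n} refl = cong suc count-above-max
  ... | no v≢    rewrite ≢⇒≡ᵇ≡false v≢ = count-isPerm n π' isPerm≡true v 1≤v (≤-pred (≤∧≢⇒< v≤ v≢))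

module _ {n π} (P : Perm (suc n) π) where
  open Perm P

  max∈ : 1 ≤ count (suc n) π
  max∈ = ≤-reflexive (sym (count-isPerm (suc n) π isPerm≡true (suc n) (s≤s z≤n) ≤-refl))

  Perm-removeMax : Perm n (remove (suc n) π)
  Perm-removeMax = record
    { length≡     = suc-injective (trans (length-remove (suc n) π max∈) length≡)
    ; inRange     = All.zipWith (λ ((1≤v , v≤) , max≢v) → 1≤v , ≤-pred (≤∧≢⇒< v≤ (max≢v ∘ sym)))
                                (All-remove (suc n) π inRange , count≡0⇒All≢ (suc n) _ max∉)
    ; isPerm≡true = isPerm-intro n (remove (suc n) π) counts≡1
    }
    where
    max∉ : count (suc n) (remove (suc n) π) ≡ 0
    max∉ = suc-injective (trans (count-remove (suc n) π max∈)
                                (count-isPerm (suc n) π isPerm≡true (suc n) (s≤s z≤n) ≤-refl))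
    counts≡1 : ∀ v → 1 ≤ v → v ≤ n → count v (remove (suc n) π) ≡ 1
    counts≡1 v 1≤v v≤n = trans (count-remove-≢ v (suc n) π (λ v≡ → 1+n≰n (subst (_≤ n) v≡ v≤n)))
                               (count-isPerm (suc n) π isPerm≡true v 1≤v (m≤n⇒m≤1+n v≤n))

  maxPosition≤ : suc (indexOf (suc n) π) ≤ suc n
  maxPosition≤ = subst (suc (indexOf (suc n) π) ≤_) length≡ (indexOf-< (suc n) π max∈)

-- Occurrences as triple sums

sum³ : ℕ → (ℕ → ℕ → ℕ → ℕ) → ℕ
sum³ n G = sumBelow n λ i → sumBelow n λ j → sumBelow n λ k → G (suc i) (suc j) (suc k)

occTerm : MeshPattern3 → List ℕ → ℕ → ℕ → ℕ → ℕ → ℕ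
occTerm p π r i j k = 𝟙 (((i <ᵇ j) ∧ (j <ᵇ k)) ∧ (not (k <ᵇ r) ∧ isOcc p π i j k))

occFrom : MeshPattern3 → List ℕ → ℕ → ℕ
occFrom p π r = sum³ (length π) (occTerm p π r)

occ≡occFrom0 : ∀ p π → occ p π ≡ occFrom p π 0
occ≡occFrom0 p π =
  trans (countᵇ-concatMap-positions f _ _ n) (sumBelow-cong n λ i _ →
  trans (countᵇ-concatMap-positions f _ _ n) (sumBelow-cong n λ j _ →
  trans (countᵇ-concatMap-positions f _ _ n) (sumBelow-cong n λ k _ →
  countᵇ-singleton-if f ((suc i <ᵇ suc j) ∧ (suc j <ᵇ suc k)) (suc i , suc j , suc k))))
  where
  n : ℕ
  n = length π
  f : ℕ × ℕ × ℕ → Bool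
  f (i , j , k) = isOcc p π i j k

sum³-punchIn : ∀ n q (G : ℕ → ℕ → ℕ → ℕ) → 1 ≤ q → q ≤ suc n →
  sum³ (suc n) G ≡ sumBelow (suc n) (λ j → sumBelow (suc n) (λ k → G q (suc j) (suc k)))
                 + (sumBelow n (λ i → sumBelow (suc n) (λ k → G (punchIn q (suc i)) q (suc k)))
                 + (sumBelow n (λ i → sumBelow n (λ j → G (punchIn q (suc i)) (punchIn q (suc j)) q))
                 + sum³ n (λ i j k → G (punchIn q i) (punchIn q j) (punchIn q k))))
sum³-punchIn n (suc q) G _ (s≤s q≤n) = begin
  sum³ (suc n) G                          ≡⟨ sumBelow-punchIn n q Gᵢ q≤n ⟩
  Gᵢ q + sumBelow n (Gᵢ ∘ punchIn q)      ≡⟨ cong (Gᵢ q +_) (sumBelow-cong n (λ i _ → splitᵢ i)) ⟩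
  Gᵢ q + sumBelow n (λ i → X i + (Y i + Z i))
    ≡⟨ cong (Gᵢ q +_) (trans (sumBelow-+ n X (λ i → Y i + Z i)) (cong (sumBelow n X +_) (sumBelow-+ n Y Z))) ⟩
  Gᵢ q + (sumBelow n X + (sumBelow n Y + sumBelow n Z)) ∎
  where
  open ≡-Reasoning
  p : ℕ → ℕ
  p i = punchIn (suc q) (suc i)
  Gᵢ : ℕ → ℕ
  Gᵢ i = sumBelow (suc n) (λ j → sumBelow (suc n) (λ k → G (suc i) (suc j) (suc k)))
  X Y Z : ℕ → ℕ
  X i = sumBelow (suc n) (λ k → G (p i) (suc q) (suc k))
  Y i = sumBelow n (λ j → G (p i) (p j) (suc q))
  Z i = sumBelow n (λ j → sumBelow n (λ k → G (p i) (p j) (p k)))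
  splitₖ : ∀ i j → sumBelow (suc n) (λ k → G (p i) (suc (punchIn q j)) (suc k))
                 ≡ G (p i) (p j) (suc q) + sumBelow n (λ k → G (p i) (p j) (p k))
  splitₖ i j = begin
    sumBelow (suc n) (λ k → G (p i) (suc (punchIn q j)) (suc k))
      ≡⟨ sumBelow-cong (suc n) (λ k _ → cong (λ t → G (p i) t (suc k)) (sym (punchIn-suc q j))) ⟩
    sumBelow (suc n) (λ k → G (p i) (p j) (suc k))
      ≡⟨ sumBelow-punchIn n q (λ k → G (p i) (p j) (suc k)) q≤n ⟩
    G (p i) (p j) (suc q) + sumBelow n (λ k → G (p i) (p j) (suc (punchIn q k)))
      ≡⟨ cong (G (p i) (p j) (suc q) +_) (sumBelow-cong n (λ k _ → cong (G (p i) (p j)) (sym (punchIn-suc q k)))) ⟩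
    G (p i) (p j) (suc q) + sumBelow n (λ k → G (p i) (p j) (p k)) ∎
  splitᵢ : ∀ i → Gᵢ (punchIn q i) ≡ X i + (Y i + Z i)
  splitᵢ i = begin
    Gᵢ (punchIn q i)
      ≡⟨ sumBelow-cong (suc n) (λ j _ → sumBelow-cong (suc n) (λ k _ →
           cong (λ t → G t (suc j) (suc k)) (sym (punchIn-suc q i)))) ⟩
    sumBelow (suc n) (λ j → sumBelow (suc n) (λ k → G (p i) (suc j) (suc k)))
      ≡⟨ sumBelow-punchIn n q (λ j → sumBelow (suc n) (λ k → G (p i) (suc j) (suc k))) q≤n ⟩
    X i + sumBelow n (λ j → sumBelow (suc n) (λ k → G (p i) (suc (punchIn q j)) (suc k)))
      ≡⟨ cong (X i +_) (trans (sumBelow-cong n (λ j _ → splitₖ i j)) (sumBelow-+ n _ _)) ⟩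
    X i + (Y i + Z i) ∎

-- Shaded boxes and the inserted maximum

inBox : ℕ → ℕ → ℕ → ℕ → ℕ → ℕ → Bool
inBox lo hi vlo vhi m v = (lo <ᵇ m) ∧ (m <ᵇ hi) ∧ (vlo <ᵇ v) ∧ (v <ᵇ vhi)

boxEmpty≡allBelow : ∀ π lo hi vlo vhi →
  boxEmpty π lo hi vlo vhi ≡ allBelow (length π) (λ m → not (inBox lo hi vlo vhi (suc m) (at π (suc m))))
boxEmpty≡allBelow π lo hi vlo vhi = allᵇ-positions _ (λ m → m) (length π)

boxEmpty-insertAt : ∀ π' q v lo hi vlo vhi vlo' vhi' → 1 ≤ q → q ≤ suc (length π') →
  (∀ m → ((vlo <ᵇ at π' m) ∧ (at π' m <ᵇ vhi)) ≡ ((vlo' <ᵇ at π' m) ∧ (at π' m <ᵇ vhi'))) →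
  boxEmpty (insertAt π' q v) (punchIn q lo) (punchIn q hi) vlo vhi
    ≡ not (inBox (punchIn q lo) (punchIn q hi) vlo vhi q v) ∧ boxEmpty π' lo hi vlo' vhi'
boxEmpty-insertAt π' (suc q) v lo hi vlo vhi vlo' vhi' _ (s≤s q≤n) sameRows = begin
  boxEmpty π lo⁺ hi⁺ vlo vhi
    ≡⟨ boxEmpty≡allBelow π lo⁺ hi⁺ vlo vhi ⟩
  allBelow (length π) (outside π lo⁺ hi⁺ vlo vhi ∘ suc)
    ≡⟨ cong (λ L → allBelow L (outside π lo⁺ hi⁺ vlo vhi ∘ suc)) (length-insertAt π' (suc q) v) ⟩
  allBelow (suc n) (outside π lo⁺ hi⁺ vlo vhi ∘ suc)
    ≡⟨ allBelow-punchIn n q (outside π lo⁺ hi⁺ vlo vhi ∘ suc) q≤n ⟩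
  outside π lo⁺ hi⁺ vlo vhi (suc q) ∧ allBelow n (outside π lo⁺ hi⁺ vlo vhi ∘ suc ∘ punchIn q)
    ≡⟨ cong₂ _∧_ (cong (λ w → not (inBox lo⁺ hi⁺ vlo vhi (suc q) w))
                       (at-insertAt π' (suc q) v (s≤s z≤n) (s≤s q≤n)))
                 (allBelow-cong n (λ m _ → oldPoint m)) ⟩
  not (inBox lo⁺ hi⁺ vlo vhi (suc q) v) ∧ allBelow n (outside π' lo hi vlo' vhi' ∘ suc)
    ≡⟨ cong (not (inBox lo⁺ hi⁺ vlo vhi (suc q) v) ∧_) (boxEmpty≡allBelow π' lo hi vlo' vhi') ⟨
  not (inBox lo⁺ hi⁺ vlo vhi (suc q) v) ∧ boxEmpty π' lo hi vlo' vhi' ∎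
  where
  open ≡-Reasoning
  π : List ℕ
  π = insertAt π' (suc q) v
  n : ℕ
  n = length π'
  lo⁺ hi⁺ : ℕ
  lo⁺ = punchIn (suc q) lo
  hi⁺ = punchIn (suc q) hi
  outside : List ℕ → ℕ → ℕ → ℕ → ℕ → ℕ → Bool
  outside ρ lo hi vlo vhi m = not (inBox lo hi vlo vhi m (at ρ m))
  oldPoint : ∀ m → outside π lo⁺ hi⁺ vlo vhi (suc (punchIn q m)) ≡ outside π' lo hi vlo' vhi' (suc m)
  oldPoint m rewrite sym (punchIn-suc q m) | punchIn-<ᵇ (suc q) lo (suc m) | punchIn-<ᵇ (suc q) (suc m) hi
                   | at-insertAt-punchIn π' (suc q) v (s≤s z≤n) (s≤s q≤n) (suc m) | sameRows (suc m) = refl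

boxEmpty-occupied : ∀ π lo hi vlo vhi m → 1 ≤ m → m ≤ length π →
  lo < m → m < hi → vlo < at π m → at π m < vhi → boxEmpty π lo hi vlo vhi ≡ false
boxEmpty-occupied π lo hi vlo vhi (suc m) _ m≤ lo<m m<hi vlo<v v<vhi =
  trans (boxEmpty≡allBelow π lo hi vlo vhi) (allBelow-false (length π) _ m m≤ inside)
  where
  inside : not (inBox lo hi vlo vhi (suc m) (at π (suc m))) ≡ false
  inside rewrite <⇒<ᵇ≡true lo<m | <⇒<ᵇ≡true m<hi | <⇒<ᵇ≡true vlo<v | <⇒<ᵇ≡true v<vhi = refl

boxEmpty-narrow : ∀ π lo hi vlo vhi → hi ≤ suc lo → boxEmpty π lo hi vlo vhi ≡ true
boxEmpty-narrow π lo hi vlo vhi hi≤ = allᵇ-true _ (map suc (upTo (length π))) outside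
  where
  outside : ∀ m → not (inBox lo hi vlo vhi m (at π m)) ≡ true
  outside m with lo <? m
  ... | no lo≮m  rewrite ≥⇒<ᵇ≡false (≮⇒≥ lo≮m) = refl
  ... | yes lo<m rewrite <⇒<ᵇ≡true lo<m | ≥⇒<ᵇ≡false {m} {hi} (≤-trans hi≤ lo<m) = refl

boxEmpty-above : ∀ π lo hi vlo vhi → (∀ m → at π m ≤ vlo) → boxEmpty π lo hi vlo vhi ≡ true
boxEmpty-above π lo hi vlo vhi below = allᵇ-true _ (map suc (upTo (length π))) outside
  where
  outside : ∀ m → not (inBox lo hi vlo vhi m (at π m)) ≡ true
  outside m rewrite ≥⇒<ᵇ≡false {vlo} {at π m} (below m) | ∧-zeroʳ (m <ᵇ hi) | ∧-zeroʳ (lo <ᵇ m) = refl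

colBound : ℕ → ℕ → ℕ → ℕ → ℕ → ℕ
colBound n i j k a = pick a 0 i j k (suc n)

rowBound : ℕ → ℕ → ℕ → ℕ → ℕ → ℕ
rowBound n x y z b = pick b 0 (min3 x y z) (mid3 x y z) (max3 x y z) (suc n)

shadedBoxEmpty : List ℕ → ℕ → ℕ → ℕ → ℕ × ℕ → Bool
shadedBoxEmpty π i j k (a , b) =
  boxEmpty π (colBound n i j k a) (colBound n i j k (suc a)) (rowBound n x y z b) (rowBound n x y z (suc b))
  where
  n : ℕ
  n = length π
  x y z : ℕ
  x = at π i
  y = at π j
  z = at π k

colBound-punchIn : ∀ n q i j k a → 1 ≤ q → q ≤ suc n →
  colBound (suc n) (punchIn q i) (punchIn q j) (punchIn q k) a ≡ punchIn q (colBound n i j k a)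
colBound-punchIn n (suc q) i j k zero                      _ _ = refl
colBound-punchIn n (suc q) i j k (suc zero)                _ _ = refl
colBound-punchIn n (suc q) i j k (suc (suc zero))          _ _ = refl
colBound-punchIn n (suc q) i j k (suc (suc (suc zero)))    _ _ = refl
colBound-punchIn n (suc q) i j k (suc (suc (suc (suc a)))) _ (s≤s q≤n) rewrite ≥⇒<ᵇ≡false q≤n = refl

maxOutsideBox : ℕ → ℕ → ℕ → ℕ → ℕ → ℕ → ℕ → ℕ → ℕ × ℕ → Bool
maxOutsideBox n q i j k x y z (a , b) =
  not (inBox (punchIn q (colBound n i j k a)) (punchIn q (colBound n i j k (suc a)))
             (rowBound (suc n) x y z b) (rowBound (suc n) x y z (suc b)) q (suc n))

shadedBoxEmpty-insertMax : ∀ π' q i j k box → 1 ≤ q → q ≤ suc (length π') → (∀ m → at π' m ≤ length π') →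
  shadedBoxEmpty (insertAt π' q (suc (length π'))) (punchIn q i) (punchIn q j) (punchIn q k) box
    ≡ maxOutsideBox (length π') q i j k (at π' i) (at π' j) (at π' k) box ∧ shadedBoxEmpty π' i j k box
shadedBoxEmpty-insertMax π' q i j k (a , b) 1≤q q≤ bounded = begin
  shadedBoxEmpty π (punchIn q i) (punchIn q j) (punchIn q k) (a , b)
    ≡⟨ cong₄ (boxEmpty π) (cols a) (cols (suc a)) (rows b) (rows (suc b)) ⟩
  boxEmpty π (punchIn q (colBound n i j k a)) (punchIn q (colBound n i j k (suc a)))
             (rowBound (suc n) x y z b) (rowBound (suc n) x y z (suc b))
    ≡⟨ boxEmpty-insertAt π' q (suc n) (colBound n i j k a) (colBound n i j k (suc a))
         (rowBound (suc n) x y z b) (rowBound (suc n) x y z (suc b)) (rowBound n x y z b) (rowBound n x y z (suc b))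
         1≤q q≤ (sameRows b) ⟩
  maxOutsideBox n q i j k x y z (a , b) ∧ shadedBoxEmpty π' i j k (a , b) ∎
  where
  open ≡-Reasoning
  n : ℕ
  n = length π'
  π : List ℕ
  π = insertAt π' q (suc n)
  x y z : ℕ
  x = at π' i
  y = at π' j
  z = at π' k
  cong₄ : ∀ (f : ℕ → ℕ → ℕ → ℕ → Bool) {a a' b b' c c' d d'} →
    a ≡ a' → b ≡ b' → c ≡ c' → d ≡ d' → f a b c d ≡ f a' b' c' d'
  cong₄ f refl refl refl refl = refl
  length-π : length π ≡ suc n
  length-π = length-insertAt π' q (suc n)
  moved : ∀ m → at π (punchIn q m) ≡ at π' m
  moved = at-insertAt-punchIn π' q (suc n) 1≤q q≤
  cols : ∀ a → colBound (length π) (punchIn q i) (punchIn q j) (punchIn q k) a ≡ punchIn q (colBound n i j k a)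
  cols a = trans (cong (λ L → colBound L (punchIn q i) (punchIn q j) (punchIn q k) a) length-π)
                 (colBound-punchIn n q i j k a 1≤q q≤)
  rows : ∀ b → rowBound (length π) (at π (punchIn q i)) (at π (punchIn q j)) (at π (punchIn q k)) b
             ≡ rowBound (suc n) x y z b
  rows b rewrite length-π | moved i | moved j | moved k = refl
  sameRows : ∀ b m → ((rowBound (suc n) x y z b <ᵇ at π' m) ∧ (at π' m <ᵇ rowBound (suc n) x y z (suc b)))
                   ≡ ((rowBound n x y z b <ᵇ at π' m) ∧ (at π' m <ᵇ rowBound n x y z (suc b)))
  sameRows zero                      m = refl
  sameRows (suc zero)                m = refl
  sameRows (suc (suc zero))          m = refl
  sameRows (suc (suc (suc zero)))    m
    rewrite <⇒<ᵇ≡true (s≤s (m≤n⇒m≤1+n (bounded m))) | <⇒<ᵇ≡true (s≤s (bounded m)) = refl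
  sameRows (suc (suc (suc (suc b)))) m
    rewrite ≥⇒<ᵇ≡false (m≤n⇒m≤1+n (m≤n⇒m≤1+n (bounded m)))
          | ≥⇒<ᵇ≡false (m≤n⇒m≤1+n (bounded m)) = refl

isOcc-insertMax : ∀ a b c R π' q i j k → 1 ≤ q → q ≤ suc (length π') → (∀ m → at π' m ≤ length π') →
  isOcc (mesh a b c R) (insertAt π' q (suc (length π'))) (punchIn q i) (punchIn q j) (punchIn q k)
    ≡ orderIso (at π' i) (at π' j) (at π' k) a b c ∧
      (allᵇ (maxOutsideBox (length π') q i j k (at π' i) (at π' j) (at π' k)) R ∧ allᵇ (shadedBoxEmpty π' i j k) R)
isOcc-insertMax a b c R π' q i j k 1≤q q≤ bounded =
  cong₂ _∧_ (cong₃ (λ x y z → orderIso x y z a b c) (moved i) (moved j) (moved k))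
            (trans (allᵇ-cong R (λ box → shadedBoxEmpty-insertMax π' q i j k box 1≤q q≤ bounded)) (allᵇ-∧ _ _ R))
  where
  moved : ∀ m → at (insertAt π' q (suc (length π'))) (punchIn q m) ≡ at π' m
  moved = at-insertAt-punchIn π' q (suc (length π')) 1≤q q≤
  cong₃ : ∀ (f : ℕ → ℕ → ℕ → Bool) {x x' y y' z z'} →
    x ≡ x' → y ≡ y' → z ≡ z' → f x y z ≡ f x' y' z'
  cong₃ f refl refl refl = refl

lowerLeft∈R₀ : ∀ a b → a ≤ 2 → b ≤ 2 → (a , b) ∈ R₀
lowerLeft∈R₀ 0 0 _ _ = here refl
lowerLeft∈R₀ 0 1 _ _ = there (here refl)
lowerLeft∈R₀ 0 2 _ _ = there (there (here refl))
lowerLeft∈R₀ 1 0 _ _ = there (there (there (here refl)))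
lowerLeft∈R₀ 1 1 _ _ = there (there (there (there (here refl))))
lowerLeft∈R₀ 1 2 _ _ = there (there (there (there (there (here refl)))))
lowerLeft∈R₀ 2 0 _ _ = there (there (there (there (there (there (here refl))))))
lowerLeft∈R₀ 2 1 _ _ = there (there (there (there (there (there (there (here refl)))))))
lowerLeft∈R₀ 2 2 _ _ = there (there (there (there (there (there (there (there (here refl))))))))
lowerLeft∈R₀ (suc (suc (suc a))) b (s≤s (s≤s ())) _
lowerLeft∈R₀ a (suc (suc (suc b))) _ (s≤s (s≤s ()))

allᵇ-R₀ : (f : ℕ × ℕ → Bool) → (∀ a b → a ≤ 2 → b ≤ 2 → f (a , b) ≡ true) → allᵇ f R₀ ≡ f (3 , 3)
allᵇ-R₀ f lowerLeft
  rewrite lowerLeft 0 0 z≤n z≤n       | lowerLeft 0 1 z≤n (s≤s z≤n)       | lowerLeft 0 2 z≤n ≤-refl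
        | lowerLeft 1 0 (s≤s z≤n) z≤n | lowerLeft 1 1 (s≤s z≤n) (s≤s z≤n) | lowerLeft 1 2 (s≤s z≤n) ≤-refl
        | lowerLeft 2 0 ≤-refl z≤n    | lowerLeft 2 1 ≤-refl (s≤s z≤n)    | lowerLeft 2 2 ≤-refl ≤-refl
  = ∧-identityʳ _

maxOutsideBox-belowMax : ∀ n q i j k x y z a b → rowBound (suc n) x y z (suc b) ≤ suc n →
  maxOutsideBox n q i j k x y z (a , b) ≡ true
maxOutsideBox-belowMax n q i j k x y z a b below rewrite ≥⇒<ᵇ≡false below =
  not-∧₃-false (punchIn q (colBound n i j k a) <ᵇ q) (q <ᵇ punchIn q (colBound n i j k (suc a)))
               (rowBound (suc n) x y z b <ᵇ suc n)
  where
  not-∧₃-false : ∀ c d e → not (c ∧ d ∧ e ∧ false) ≡ true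
  not-∧₃-false true  true  true  = refl
  not-∧₃-false true  true  false = refl
  not-∧₃-false true  false _     = refl
  not-∧₃-false false _     _     = refl

-- Below the maximum the occurrence region is shaded everywhere, so the new
-- maximum can only spoil an occurrence by landing in box (3, 3), right of k.
maxOutsideShading : ∀ n q i j k x y z → 1 ≤ q → q ≤ suc n →
  min3 x y z ≤ n → mid3 x y z ≤ n → max3 x y z ≤ n →
  allᵇ (maxOutsideBox n q i j k x y z) R₀ ≡ not (k <ᵇ q)
maxOutsideShading n q i j k x y z 1≤q q≤ min≤n mid≤n max≤n =
  trans (allᵇ-R₀ (maxOutsideBox n q i j k x y z) lowerLeft) box33
  where
  lowerLeft : ∀ a b → a ≤ 2 → b ≤ 2 → maxOutsideBox n q i j k x y z (a , b) ≡ true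
  lowerLeft a zero                   _ _ = maxOutsideBox-belowMax n q i j k x y z a 0 (m≤n⇒m≤1+n min≤n)
  lowerLeft a (suc zero)             _ _ = maxOutsideBox-belowMax n q i j k x y z a 1 (m≤n⇒m≤1+n mid≤n)
  lowerLeft a (suc (suc zero))       _ _ = maxOutsideBox-belowMax n q i j k x y z a 2 (m≤n⇒m≤1+n max≤n)
  lowerLeft a (suc (suc (suc b))) _ (s≤s (s≤s ()))
  box33 : maxOutsideBox n q i j k x y z (3 , 3) ≡ not (k <ᵇ q)
  box33 rewrite ≥⇒<ᵇ≡false {suc n} {q} q≤ | <⇒<ᵇ≡true {q} {suc (suc n)} (s≤s q≤)
              | <⇒<ᵇ≡true {max3 x y z} {suc n} (s≤s max≤n) | <⇒<ᵇ≡true {n} {suc n} (n<1+n n)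
              | punchIn-<ᵇ-pivot q k = cong not (∧-identityʳ _)

lowerLeftColumn : ∀ n i j k m → 1 ≤ m → m < k → m ≢ i → m ≢ j →
  Σ ℕ (λ a → a ≤ 2 × colBound n i j k a < m × m < colBound n i j k (suc a))
lowerLeftColumn n i j k m 1≤m m<k m≢i m≢j with m <? i | m <? j
... | yes m<i | _       = 0 , z≤n , 1≤m , m<i
... | no m≮i  | yes m<j = 1 , s≤s z≤n , ≤∧≢⇒< (≮⇒≥ m≮i) (m≢i ∘ sym) , m<j
... | no _    | no m≮j  = 2 , s≤s (s≤s z≤n) , ≤∧≢⇒< (≮⇒≥ m≮j) (m≢j ∘ sym) , m<k

lowerLeftRow : ∀ n x y z w → 0 < w → w < max3 x y z → w ≢ min3 x y z → w ≢ mid3 x y z →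
  Σ ℕ (λ b → b ≤ 2 × rowBound n x y z b < w × w < rowBound n x y z (suc b))
lowerLeftRow n x y z w 0<w w<max w≢min w≢mid with w <? min3 x y z | w <? mid3 x y z
... | yes w<min | _         = 0 , z≤n , 0<w , w<min
... | no w≮min  | yes w<mid = 1 , s≤s z≤n , ≤∧≢⇒< (≮⇒≥ w≮min) (w≢min ∘ sym) , w<mid
... | no _      | no w≮mid  = 2 , s≤s (s≤s z≤n) , ≤∧≢⇒< (≮⇒≥ w≮mid) (w≢mid ∘ sym) , w<max

-- Any further point left of k and below the largest pattern value lies in one
-- of the nine shaded boxes of the lower-left block.
shading-occupied : ∀ π i j k m → 1 ≤ m → m ≤ length π → m < k → m ≢ i → m ≢ j →
  let x = at π i ; y = at π j ; z = at π k ; w = at π m in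
  0 < w → w < max3 x y z → w ≢ min3 x y z → w ≢ mid3 x y z →
  allᵇ (shadedBoxEmpty π i j k) R₀ ≡ false
shading-occupied π i j k m 1≤m m≤ m<k m≢i m≢j 0<w w<max w≢min w≢mid
  with a , a≤2 , lo<m , m<hi ← lowerLeftColumn (length π) i j k m 1≤m m<k m≢i m≢j
  with b , b≤2 , vlo<w , w<vhi ← lowerLeftRow (length π) (at π i) (at π j) (at π k) (at π m)
                                                0<w w<max w≢min w≢mid =
  allᵇ-false (shadedBoxEmpty π i j k) R₀ (lowerLeft∈R₀ a b a≤2 b≤2)
    (boxEmpty-occupied π _ _ _ _ m 1≤m m≤ lo<m m<hi vlo<w w<vhi)

shading-prefix : ∀ π → (∀ m → at π m ≤ max3 (at π 1) (at π 2) (at π 3)) →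
  allᵇ (shadedBoxEmpty π 1 2 3) R₀ ≡ true
shading-prefix π below =
  trans (allᵇ-R₀ (shadedBoxEmpty π 1 2 3)
                  (λ a b a≤2 b≤2 → narrow a (rowBound n x y z b) (rowBound n x y z (suc b)) a≤2))
        (boxEmpty-above π 3 (suc n) (max3 x y z) (suc n) below)
  where
  n : ℕ
  n = length π
  x y z : ℕ
  x = at π 1
  y = at π 2
  z = at π 3
  narrow : ∀ a vlo vhi → a ≤ 2 → boxEmpty π (colBound n 1 2 3 a) (colBound n 1 2 3 (suc a)) vlo vhi ≡ true
  narrow zero             vlo vhi _ = boxEmpty-narrow π 0 1 vlo vhi ≤-refl
  narrow (suc zero)       vlo vhi _ = boxEmpty-narrow π 1 2 vlo vhi ≤-refl
  narrow (suc (suc zero)) vlo vhi _ = boxEmpty-narrow π 2 3 vlo vhi ≤-refl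
  narrow (suc (suc (suc a))) _ _ (s≤s (s≤s ()))

orderIso-123 : ∀ x y z → orderIso x y z 1 2 3 ≡ (x <ᵇ y) ∧ (x <ᵇ z) ∧ (y <ᵇ z)
orderIso-123 x y z with x <ᵇ y | x <ᵇ z | y <ᵇ z
... | true  | true  | true  = refl
... | true  | true  | false = refl
... | true  | false | _     = refl
... | false | _     | _     = refl

orderIso-132 : ∀ x y z → orderIso x y z 1 3 2 ≡ (x <ᵇ y) ∧ (x <ᵇ z) ∧ not (y <ᵇ z)
orderIso-132 x y z with x <ᵇ y | x <ᵇ z | y <ᵇ z
... | true  | true  | true  = refl
... | true  | true  | false = refl
... | true  | false | _     = refl
... | false | _     | _     = refl

∧₃-true : ∀ {a b c} → a ∧ b ∧ c ≡ true → (a ≡ true) × (b ≡ true) × (c ≡ true)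
∧₃-true {true} {true} {true} _ = refl , refl , refl

sort3-xyz : ∀ {x y z} → x < y → y < z → (min3 x y z ≡ x) × (mid3 x y z ≡ y) × (max3 x y z ≡ z)
sort3-xyz {x} {y} {z} x<y y<z
  rewrite <⇒<ᵇ≡true x<y | <⇒<ᵇ≡true (<-trans x<y y<z)
        | ≥⇒<ᵇ≡false (<⇒≤ x<y) | ≥⇒<ᵇ≡false (<⇒≤ y<z) =
  refl , trans (cong (_∸ (x + z)) (+-leftSwap′ x y z)) (m+n∸m≡n (x + z) y) , refl
  where
  +-leftSwap′ : ∀ x y z → x + y + z ≡ x + z + y
  +-leftSwap′ x y z = trans (+-assoc x y z) (trans (cong (x +_) (+-comm y z)) (sym (+-assoc x z y)))

sort3-xzy : ∀ {x y z} → x < z → z ≤ y → (min3 x y z ≡ x) × (mid3 x y z ≡ z) × (max3 x y z ≡ y)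
sort3-xzy {x} {y} {z} x<z z≤y with z <? y
... | yes z<y rewrite <⇒<ᵇ≡true (<-trans x<z z<y) | <⇒<ᵇ≡true x<z
                    | ≥⇒<ᵇ≡false (<⇒≤ (<-trans x<z z<y)) | <⇒<ᵇ≡true z<y =
  refl , m+n∸m≡n (x + y) z , refl
... | no z≮y with refl ← ≤-antisym z≤y (≮⇒≥ z≮y)
  rewrite <⇒<ᵇ≡true x<z | ≥⇒<ᵇ≡false (<⇒≤ x<z) | ≥⇒<ᵇ≡false (≤-refl {z}) =
  refl , m+n∸m≡n (x + z) z , refl

orderIso-123-x≮y : ∀ x y z → (x <ᵇ y) ≡ false → orderIso x y z 1 2 3 ≡ false
orderIso-123-x≮y x y z x≮y rewrite orderIso-123 x y z | x≮y = refl

orderIso-123-y≮z : ∀ x y z → (y <ᵇ z) ≡ false → orderIso x y z 1 2 3 ≡ false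
orderIso-123-y≮z x y z y≮z rewrite orderIso-123 x y z | y≮z =
  trans (cong ((x <ᵇ y) ∧_) (∧-zeroʳ (x <ᵇ z))) (∧-zeroʳ (x <ᵇ y))

orderIso-132-x≮y : ∀ x y z → (x <ᵇ y) ≡ false → orderIso x y z 1 3 2 ≡ false
orderIso-132-x≮y x y z x≮y rewrite orderIso-132 x y z | x≮y = refl

orderIso-132-x≮z : ∀ x y z → (x <ᵇ z) ≡ false → orderIso x y z 1 3 2 ≡ false
orderIso-132-x≮z x y z x≮z rewrite orderIso-132 x y z | x≮z = ∧-zeroʳ (x <ᵇ y)

orderIso-132-y<z : ∀ x y z → (y <ᵇ z) ≡ true → orderIso x y z 1 3 2 ≡ false
orderIso-132-y<z x y z y<z rewrite orderIso-132 x y z | y<z =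
  trans (cong ((x <ᵇ y) ∧_) (∧-zeroʳ (x <ᵇ z))) (∧-zeroʳ (x <ᵇ y))

maxOutsideShading-123 : ∀ n q i j k x y z → 1 ≤ q → q ≤ suc n → x ≤ n → y ≤ n → z ≤ n →
  orderIso x y z 1 2 3 ≡ true → allᵇ (maxOutsideBox n q i j k x y z) R₀ ≡ not (k <ᵇ q)
maxOutsideShading-123 n q i j k x y z 1≤q q≤ x≤ y≤ z≤ xyz
  with x<y , _ , y<z ← ∧₃-true {x <ᵇ y} {x <ᵇ z} {y <ᵇ z} (trans (sym (orderIso-123 x y z)) xyz)
  with min≡x , mid≡y , max≡z ← sort3-xyz (<ᵇ≡true⇒< x<y) (<ᵇ≡true⇒< y<z) =
  maxOutsideShading n q i j k x y z 1≤q q≤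
    (subst (_≤ n) (sym min≡x) x≤) (subst (_≤ n) (sym mid≡y) y≤) (subst (_≤ n) (sym max≡z) z≤)

maxOutsideShading-132 : ∀ n q i j k x y z → 1 ≤ q → q ≤ suc n → x ≤ n → y ≤ n → z ≤ n →
  orderIso x y z 1 3 2 ≡ true → allᵇ (maxOutsideBox n q i j k x y z) R₀ ≡ not (k <ᵇ q)
maxOutsideShading-132 n q i j k x y z 1≤q q≤ x≤ y≤ z≤ xzy
  with _ , x<z , y≮z ← ∧₃-true {x <ᵇ y} {x <ᵇ z} {not (y <ᵇ z)} (trans (sym (orderIso-132 x y z)) xzy)
  with min≡x , mid≡z , max≡y ← sort3-xzy (<ᵇ≡true⇒< x<z) (<ᵇ≡false⇒≥ (not-injective y≮z)) =
  maxOutsideShading n q i j k x y z 1≤q q≤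
    (subst (_≤ n) (sym min≡x) x≤) (subst (_≤ n) (sym mid≡z) z≤) (subst (_≤ n) (sym max≡y) y≤)

not-<ᵇ-punchIn-⊔ : ∀ q k r → not (punchIn q k <ᵇ r) ∧ not (k <ᵇ q) ≡ not (k <ᵇ q ⊔ (r ∸ 1))
not-<ᵇ-punchIn-⊔ q k r with k <? q
... | yes k<q rewrite <⇒<ᵇ≡true k<q | <⇒<ᵇ≡true (<-≤-trans k<q (m≤m⊔n q (r ∸ 1))) = ∧-zeroʳ _
... | no k≮q rewrite ≥⇒<ᵇ≡false (≮⇒≥ k≮q) = trans (∧-identityʳ _) (cong not (suc-<ᵇ r))
  where
  q≤k : q ≤ k
  q≤k = ≮⇒≥ k≮q
  suc-<ᵇ : ∀ r → (suc k <ᵇ r) ≡ (k <ᵇ q ⊔ (r ∸ 1))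
  suc-<ᵇ zero = sym (≥⇒<ᵇ≡false (⊔-lub q≤k z≤n))
  suc-<ᵇ (suc r) with k <? r
  ... | yes k<r = trans (<⇒<ᵇ≡true (s≤s k<r)) (sym (<⇒<ᵇ≡true (<-≤-trans k<r (m≤n⊔m q r))))
  ... | no k≮r  = trans (≥⇒<ᵇ≡false (s≤s (≮⇒≥ k≮r))) (sym (≥⇒<ᵇ≡false (⊔-lub q≤k (≮⇒≥ k≮r))))

-- An old occurrence survives iff it ends at or after q, i.e. the maximum is not
-- in box (3, 3).
occTerm-insertMax : ∀ a b c π' q r i j k → 1 ≤ q → q ≤ suc (length π') → (∀ m → at π' m ≤ length π') →
  (orderIso (at π' i) (at π' j) (at π' k) a b c ≡ true →
     allᵇ (maxOutsideBox (length π') q i j k (at π' i) (at π' j) (at π' k)) R₀ ≡ not (k <ᵇ q)) →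
  occTerm (mesh a b c R₀) (insertAt π' q (suc (length π'))) r (punchIn q i) (punchIn q j) (punchIn q k)
    ≡ occTerm (mesh a b c R₀) π' (q ⊔ (r ∸ 1)) i j k
occTerm-insertMax a b c π' q r i j k 1≤q q≤ bounded shading
  rewrite punchIn-<ᵇ q i j | punchIn-<ᵇ q j k | isOcc-insertMax a b c R₀ π' q i j k 1≤q q≤ bounded =
  cong (λ t → 𝟙 (((i <ᵇ j) ∧ (j <ᵇ k)) ∧ t))
       (trans (regroup (not (punchIn q k <ᵇ r)) (not (k <ᵇ q)) _ _ _ shading)
              (cong (_∧ (orderIso (at π' i) (at π' j) (at π' k) a b c ∧ allᵇ (shadedBoxEmpty π' i j k) R₀))
                    (not-<ᵇ-punchIn-⊔ q k r)))
  where
  regroup : ∀ (A B iso new old : Bool) → (iso ≡ true → new ≡ B) →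
    A ∧ (iso ∧ (new ∧ old)) ≡ (A ∧ B) ∧ (iso ∧ old)
  regroup A B true  new old new≡B rewrite new≡B refl = sym (∧-assoc A B old)
  regroup A B false new old _     = trans (∧-zeroʳ A) (sym (∧-zeroʳ (A ∧ B)))

p123 p132 : MeshPattern3
p123 = mesh 1 2 3 R₀
p132 = mesh 1 3 2 R₀

ascent : List ℕ → Bool
ascent π = at π 1 <ᵇ at π 2

-- The occurrence at positions (1, 2, 3) created by inserting the maximum at
-- position q, where c is the position of the 3 in the pattern.
newOcc : ℕ → ℕ → Bool → ℕ → ℕ
newOcc c q ascending r = 𝟙 (((q ≡ᵇ c) ∧ ascending) ∧ not (3 <ᵇ r))

occTerm-unordered : ∀ p π r i j k → ((i <ᵇ j) ∧ (j <ᵇ k)) ≡ false → occTerm p π r i j k ≡ 0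
occTerm-unordered p π r i j k unordered rewrite unordered = refl

𝟙-∧-∧-false : ∀ a b → 𝟙 (a ∧ (b ∧ false)) ≡ 0
𝟙-∧-∧-false true  true  = refl
𝟙-∧-∧-false true  false = refl
𝟙-∧-∧-false false b     = refl

occTerm-notIso : ∀ a b c R π r i j k → orderIso (at π i) (at π j) (at π k) a b c ≡ false →
  occTerm (mesh a b c R) π r i j k ≡ 0
occTerm-notIso a b c R π r i j k notIso rewrite notIso = 𝟙-∧-∧-false ((i <ᵇ j) ∧ (j <ᵇ k)) (not (k <ᵇ r))

occTerm-unshaded : ∀ a b c π r i j k → allᵇ (shadedBoxEmpty π i j k) R₀ ≡ false →
  occTerm (mesh a b c R₀) π r i j k ≡ 0
occTerm-unshaded a b c π r i j k unshaded rewrite unshaded | ∧-zeroʳ (orderIso (at π i) (at π j) (at π k) a b c) =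
  𝟙-∧-∧-false ((i <ᵇ j) ∧ (j <ᵇ k)) (not (k <ᵇ r))

occTerm-prefix : ∀ a b c π r → orderIso (at π 1) (at π 2) (at π 3) a b c ≡ true →
  allᵇ (shadedBoxEmpty π 1 2 3) R₀ ≡ true → occTerm (mesh a b c R₀) π r 1 2 3 ≡ 𝟙 (not (3 <ᵇ r))
occTerm-prefix a b c π r iso shaded rewrite iso | shaded = cong 𝟙 (∧-identityʳ _)

occTerm-123-prefix : ∀ π r → at π 2 < at π 3 → (∀ m → at π m ≤ at π 3) →
  occTerm p123 π r 1 2 3 ≡ 𝟙 (ascent π ∧ not (3 <ᵇ r))
occTerm-123-prefix π r y<z below with at π 1 <? at π 2
... | no x≮y = trans (occTerm-notIso 1 2 3 R₀ π r 1 2 3 (orderIso-123-x≮y x y z x≮ᵇy))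
                     (cong (λ t → 𝟙 (t ∧ not (3 <ᵇ r))) (sym x≮ᵇy))
  where
  x y z : ℕ
  x = at π 1
  y = at π 2
  z = at π 3
  x≮ᵇy : (x <ᵇ y) ≡ false
  x≮ᵇy = ≥⇒<ᵇ≡false (≮⇒≥ x≮y)
... | yes x<y =
  trans (occTerm-prefix 1 2 3 π r iso shaded) (cong (λ t → 𝟙 (t ∧ not (3 <ᵇ r))) (sym (<⇒<ᵇ≡true x<y)))
  where
  x y z : ℕ
  x = at π 1
  y = at π 2
  z = at π 3
  iso : orderIso x y z 1 2 3 ≡ true
  iso rewrite orderIso-123 x y z | <⇒<ᵇ≡true x<y | <⇒<ᵇ≡true (<-trans x<y y<z) | <⇒<ᵇ≡true y<z = refl
  shaded : allᵇ (shadedBoxEmpty π 1 2 3) R₀ ≡ true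
  shaded = shading-prefix π (λ m → subst (at π m ≤_) (sym (proj₂ (proj₂ (sort3-xyz x<y y<z)))) (below m))

occTerm-132-prefix : ∀ π r → at π 3 < at π 2 → (∀ m → at π m ≤ at π 2) →
  occTerm p132 π r 1 2 3 ≡ 𝟙 ((at π 1 <ᵇ at π 3) ∧ not (3 <ᵇ r))
occTerm-132-prefix π r z<y below with at π 1 <? at π 3
... | no x≮z = trans (occTerm-notIso 1 3 2 R₀ π r 1 2 3 (orderIso-132-x≮z x y z x≮ᵇz))
                     (cong (λ t → 𝟙 (t ∧ not (3 <ᵇ r))) (sym x≮ᵇz))
  where
  x y z : ℕ
  x = at π 1
  y = at π 2
  z = at π 3
  x≮ᵇz : (x <ᵇ z) ≡ false
  x≮ᵇz = ≥⇒<ᵇ≡false (≮⇒≥ x≮z)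
... | yes x<z =
  trans (occTerm-prefix 1 3 2 π r iso shaded) (cong (λ t → 𝟙 (t ∧ not (3 <ᵇ r))) (sym (<⇒<ᵇ≡true x<z)))
  where
  x y z : ℕ
  x = at π 1
  y = at π 2
  z = at π 3
  iso : orderIso x y z 1 3 2 ≡ true
  iso rewrite orderIso-132 x y z | <⇒<ᵇ≡true (<-trans x<z z<y) | <⇒<ᵇ≡true x<z | ≥⇒<ᵇ≡false (<⇒≤ z<y) = refl
  shaded : allᵇ (shadedBoxEmpty π 1 2 3) R₀ ≡ true
  shaded = shading-prefix π (λ m → subst (at π m ≤_) (sym (proj₂ (proj₂ (sort3-xzy x<z (<⇒≤ z<y))))) (below m))

spareEarlierPosition : ∀ {i j k} → 1 ≤ i → i < j → j < k → ¬ (i ≡ 1 × j ≡ 2 × k ≡ 3) →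
  Σ ℕ (λ m → 1 ≤ m × m < k × m ≢ i × m ≢ j)
spareEarlierPosition {i} {j} {k} 1≤i i<j j<k not123 with i ≟ 1 | j ≟ 2
... | no i≢1   | _        = 1 , ≤-refl , <-trans (≤∧≢⇒< 1≤i (i≢1 ∘ sym)) (<-trans i<j j<k) , i≢1 ∘ sym ,
                            (λ 1≡j → <-irrefl 1≡j (≤-<-trans 1≤i i<j))
... | yes refl | no j≢2   = 2 , s≤s z≤n , <-trans (≤∧≢⇒< i<j (j≢2 ∘ sym)) j<k , (λ ()) , j≢2 ∘ sym
... | yes refl | yes refl = 3 , s≤s z≤n , ≤∧≢⇒< j<k (λ 3≡k → not123 (refl , refl , sym 3≡k)) , (λ ()) , (λ ())

module InsertMax (π' : List ℕ) (P' : Perm (length π') π') (q : ℕ) (1≤q : 1 ≤ q) (q≤ : q ≤ suc (length π')) where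

  n : ℕ
  n = length π'

  π : List ℕ
  π = insertAt π' q (suc n)

  P : Perm (suc n) π
  P = Perm-insertMax q P' 1≤q q≤

  private
    module P = Perm P
    module P' = Perm P'

  length-π : length π ≡ suc n
  length-π = length-insertAt π' q (suc n)

  at-q : at π q ≡ suc n
  at-q = at-insertAt π' q (suc n) 1≤q q≤

  moved : ∀ m → at π (punchIn q m) ≡ at π' m
  moved = at-insertAt-punchIn π' q (suc n) 1≤q q≤

  belowMax : ∀ m → m ≢ q → at π m ≤ n
  belowMax m m≢q = ≤-pred (≤∧≢⇒< (P.at≤ m) λ πm≡ →
    m≢q (sym (P.at-injective q m (subst (1 ≤_) (sym at-q) (s≤s z≤n)) (trans at-q (sym πm≡)))))

  <-max : ∀ m → m ≢ q → at π m < at π q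
  <-max m m≢q = subst (at π m <_) (sym at-q) (s≤s (belowMax m m≢q))

  ≤-max : ∀ m → at π m ≤ at π q
  ≤-max m = subst (at π m ≤_) (sym at-q) (P.at≤ m)

  max-≮ᵇ : ∀ m → m ≢ q → (at π q <ᵇ at π m) ≡ false
  max-≮ᵇ m m≢q = ≥⇒<ᵇ≡false (<⇒≤ (<-max m m≢q))

  at-≢ : ∀ m m' → 1 ≤ m → m ≤ suc n → m ≢ m' → at π m ≢ at π m'
  at-≢ m m' 1≤m m≤ m≢m' πm≡πm' = m≢m' (P.at-injective m m' (P.at-positive m 1≤m m≤) πm≡πm')

  max-not-first : ∀ a b c → (∀ x y z → (x <ᵇ y) ≡ false → orderIso x y z a b c ≡ false) →
    ∀ r j k → occTerm (mesh a b c R₀) π r q j k ≡ 0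
  max-not-first a b c notIso r j k with q <? j
  ... | no q≮j  = occTerm-unordered (mesh a b c R₀) π r q j k (cong (_∧ (j <ᵇ k)) (≥⇒<ᵇ≡false (≮⇒≥ q≮j)))
  ... | yes q<j = occTerm-notIso a b c R₀ π r q j k
                    (notIso (at π q) (at π j) (at π k) (max-≮ᵇ j (λ j≡q → <-irrefl (sym j≡q) q<j)))

  max-not-second-123 : ∀ r i k → occTerm p123 π r i q k ≡ 0
  max-not-second-123 r i k with q <? k
  ... | no q≮k  = occTerm-unordered p123 π r i q k
                    (trans (cong ((i <ᵇ q) ∧_) (≥⇒<ᵇ≡false (≮⇒≥ q≮k))) (∧-zeroʳ _))
  ... | yes q<k = occTerm-notIso 1 2 3 R₀ π r i q k
                    (orderIso-123-y≮z (at π i) (at π q) (at π k) (max-≮ᵇ k (λ k≡q → <-irrefl (sym k≡q) q<k)))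

  max-not-last-132 : ∀ r i j → occTerm p132 π r i j q ≡ 0
  max-not-last-132 r i j with j <? q
  ... | no j≮q  = occTerm-unordered p132 π r i j q
                    (trans (cong ((i <ᵇ j) ∧_) (≥⇒<ᵇ≡false (≮⇒≥ j≮q))) (∧-zeroʳ _))
  ... | yes j<q = occTerm-notIso 1 3 2 R₀ π r i j q
                    (orderIso-132-y<z (at π i) (at π j) (at π q) (<⇒<ᵇ≡true (<-max j (λ j≡q → <-irrefl j≡q j<q))))

  -- If the maximum is the 3 of an occurrence of 123 ending at q, the positions
  -- before q other than the 1 and the 2 would lie in the shaded region.
  occTerm-123-max-last-off : ∀ r i j → 1 ≤ i → ¬ (i ≡ 1 × j ≡ 2 × q ≡ 3) →
    occTerm p123 π r (punchIn q i) (punchIn q j) q ≡ 0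
  occTerm-123-max-last-off r i j 1≤i not123 with i <? j | j <? q
  ... | no i≮j | _ = occTerm-unordered p123 π r _ _ q
          (cong (_∧ (punchIn q j <ᵇ q)) (trans (punchIn-<ᵇ q i j) (≥⇒<ᵇ≡false (≮⇒≥ i≮j))))
  ... | yes i<j | no j≮q = occTerm-unordered p123 π r _ _ q
          (cong₂ _∧_ (trans (punchIn-<ᵇ q i j) (<⇒<ᵇ≡true i<j))
                     (trans (punchIn-<ᵇ-pivot q j) (≥⇒<ᵇ≡false (≮⇒≥ j≮q))))
  ... | yes i<j | yes j<q rewrite punchIn-< q i (<-trans i<j j<q) | punchIn-< q j j<q with at π i <? at π j
  ...   | no x≮y = occTerm-notIso 1 2 3 R₀ π r i j q
                     (orderIso-123-x≮y (at π i) (at π j) (at π q) (≥⇒<ᵇ≡false (≮⇒≥ x≮y)))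
  ...   | yes x<y
    with m , 1≤m , m<q , m≢i , m≢j ← spareEarlierPosition 1≤i i<j j<q not123
    with min≡x , mid≡y , max≡z ← sort3-xyz x<y (<-max j (λ j≡q → <-irrefl j≡q j<q)) =
    occTerm-unshaded 1 2 3 π r i j q
      (shading-occupied π i j q m 1≤m (subst (m ≤_) (sym length-π) m≤) m<q m≢i m≢j (P.at-positive m 1≤m m≤)
        (subst (at π m <_) (sym max≡z) (<-max m (λ m≡q → <-irrefl m≡q m<q)))
        (subst (at π m ≢_) (sym min≡x) (at-≢ m i 1≤m m≤ m≢i))
        (subst (at π m ≢_) (sym mid≡y) (at-≢ m j 1≤m m≤ m≢j)))
    where
    m≤ : m ≤ suc n
    m≤ = ≤-trans (<⇒≤ m<q) q≤

  occTerm-132-max-middle-off : ∀ r i k → 1 ≤ i → k ≤ suc n → ¬ (i ≡ 1 × q ≡ 2 × k ≡ 3) →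
    occTerm p132 π r (punchIn q i) q k ≡ 0
  occTerm-132-max-middle-off r i k 1≤i k≤ not132 with i <? q | q <? k
  ... | no i≮q | _ = occTerm-unordered p132 π r _ q k
          (cong (_∧ (q <ᵇ k)) (trans (punchIn-<ᵇ-pivot q i) (≥⇒<ᵇ≡false (≮⇒≥ i≮q))))
  ... | yes i<q | no q≮k = occTerm-unordered p132 π r _ q k
          (cong₂ _∧_ (trans (punchIn-<ᵇ-pivot q i) (<⇒<ᵇ≡true i<q)) (≥⇒<ᵇ≡false (≮⇒≥ q≮k)))
  ... | yes i<q | yes q<k rewrite punchIn-< q i i<q with at π i <? at π k
  ...   | no x≮z = occTerm-notIso 1 3 2 R₀ π r i q k
                     (orderIso-132-x≮z (at π i) (at π q) (at π k) (≥⇒<ᵇ≡false (≮⇒≥ x≮z)))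
  ...   | yes x<z
    with m , 1≤m , m<k , m≢i , m≢q ← spareEarlierPosition 1≤i i<q q<k not132
    with min≡x , mid≡z , max≡y ← sort3-xzy x<z (<⇒≤ (<-max k (λ k≡q → <-irrefl (sym k≡q) q<k))) =
    occTerm-unshaded 1 3 2 π r i q k
      (shading-occupied π i q k m 1≤m (subst (m ≤_) (sym length-π) m≤) m<k m≢i m≢q (P.at-positive m 1≤m m≤)
        (subst (at π m <_) (sym max≡y) (<-max m m≢q))
        (subst (at π m ≢_) (sym min≡x) (at-≢ m i 1≤m m≤ m≢i))
        (subst (at π m ≢_) (sym mid≡z) (at-≢ m k 1≤m m≤ (λ m≡k → <-irrefl m≡k m<k))))
    where
    m≤ : m ≤ suc n
    m≤ = ≤-trans (<⇒≤ m<k) k≤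

  occTerm-123-max-last : ∀ r →
    sumBelow n (λ i → sumBelow n (λ j → occTerm p123 π r (punchIn q (suc i)) (punchIn q (suc j)) q))
      ≡ newOcc 3 q (ascent π') r
  occTerm-123-max-last r with q ≟ 3
  ... | no q≢3 rewrite ≢⇒≡ᵇ≡false q≢3 =
    sumBelow-zero n _ λ i _ → sumBelow-zero n _ λ j _ →
      occTerm-123-max-last-off r (suc i) (suc j) (s≤s z≤n) (λ (_ , _ , q≡3) → q≢3 q≡3)
  ... | yes refl = begin
    sumBelow n (λ i → sumBelow n (λ j → occTerm p123 π r (punchIn 3 (suc i)) (punchIn 3 (suc j)) 3))
      ≡⟨ sumBelow-single n _ 0 (≤-trans (s≤s z≤n) 2≤n) (λ i _ i≢0 → sumBelow-zero n _ λ j _ →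
           occTerm-123-max-last-off r (suc i) (suc j) (s≤s z≤n) (λ (1+i≡1 , _) → i≢0 (suc-injective 1+i≡1))) ⟩
    sumBelow n (λ j → occTerm p123 π r 1 (punchIn 3 (suc j)) 3)
      ≡⟨ sumBelow-single n _ 1 2≤n (λ j _ j≢1 →
           occTerm-123-max-last-off r 1 (suc j) ≤-refl (λ (_ , 1+j≡2 , _) → j≢1 (suc-injective 1+j≡2))) ⟩
    occTerm p123 π r 1 2 3
      ≡⟨ occTerm-123-prefix π r (<-max 2 λ ()) ≤-max ⟩
    𝟙 (ascent π ∧ not (3 <ᵇ r))
      ≡⟨ cong₂ (λ x y → 𝟙 ((x <ᵇ y) ∧ not (3 <ᵇ r))) (moved 1) (moved 2) ⟩
    𝟙 (ascent π' ∧ not (3 <ᵇ r)) ∎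
    where
    open ≡-Reasoning
    2≤n : 2 ≤ n
    2≤n = ≤-pred q≤

  occTerm-132-max-middle : ∀ r →
    sumBelow n (λ i → sumBelow (suc n) (λ k → occTerm p132 π r (punchIn q (suc i)) q (suc k)))
      ≡ newOcc 2 q (ascent π') r
  occTerm-132-max-middle r with q ≟ 2 | 2 ≤? n
  ... | no q≢2 | _ rewrite ≢⇒≡ᵇ≡false q≢2 =
    sumBelow-zero n _ λ i _ → sumBelow-zero (suc n) _ λ k k< →
      occTerm-132-max-middle-off r (suc i) (suc k) (s≤s z≤n) k< (λ (_ , q≡2 , _) → q≢2 q≡2)
  ... | yes refl | no 2≰n rewrite at-beyond π' 2 (≰⇒> 2≰n) | ≥⇒<ᵇ≡false {at π' 1} {0} z≤n =
    sumBelow-zero n _ λ i _ → sumBelow-zero (suc n) _ λ k k< →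
      occTerm-132-max-middle-off r (suc i) (suc k) (s≤s z≤n) k<
        (λ (_ , _ , 1+k≡3) → 2≰n (subst (_≤ n) (suc-injective 1+k≡3) (≤-pred k<)))
  ... | yes refl | yes 2≤n = begin
    sumBelow n (λ i → sumBelow (suc n) (λ k → occTerm p132 π r (punchIn 2 (suc i)) 2 (suc k)))
      ≡⟨ sumBelow-single n _ 0 (≤-trans (s≤s z≤n) 2≤n) (λ i _ i≢0 → sumBelow-zero (suc n) _ λ k k< →
           occTerm-132-max-middle-off r (suc i) (suc k) (s≤s z≤n) k< (λ (1+i≡1 , _) → i≢0 (suc-injective 1+i≡1))) ⟩
    sumBelow (suc n) (λ k → occTerm p132 π r 1 2 (suc k))
      ≡⟨ sumBelow-single (suc n) _ 2 (s≤s 2≤n) (λ k k< k≢2 →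
           occTerm-132-max-middle-off r 1 (suc k) ≤-refl k< (λ (_ , _ , 1+k≡3) → k≢2 (suc-injective 1+k≡3))) ⟩
    occTerm p132 π r 1 2 3
      ≡⟨ occTerm-132-prefix π r (<-max 3 λ ()) ≤-max ⟩
    𝟙 ((at π 1 <ᵇ at π 3) ∧ not (3 <ᵇ r))
      ≡⟨ cong₂ (λ x y → 𝟙 ((x <ᵇ y) ∧ not (3 <ᵇ r))) (moved 1) (moved 2) ⟩
    𝟙 (ascent π' ∧ not (3 <ᵇ r)) ∎
    where open ≡-Reasoning

  occTerm-avoiding-max : ∀ a b c r →
    (∀ i j k → orderIso (at π' i) (at π' j) (at π' k) a b c ≡ true →
       allᵇ (maxOutsideBox n q i j k (at π' i) (at π' j) (at π' k)) R₀ ≡ not (k <ᵇ q)) →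
    sum³ n (λ i j k → occTerm (mesh a b c R₀) π r (punchIn q i) (punchIn q j) (punchIn q k))
      ≡ occFrom (mesh a b c R₀) π' (q ⊔ (r ∸ 1))
  occTerm-avoiding-max a b c r shading =
    sumBelow-cong n λ i _ → sumBelow-cong n λ j _ → sumBelow-cong n λ k _ →
      occTerm-insertMax a b c π' q r (suc i) (suc j) (suc k) 1≤q q≤ P'.at≤ (shading (suc i) (suc j) (suc k))

  occFrom-123-insertMax : ∀ r → occFrom p123 π r ≡ occFrom p123 π' (q ⊔ (r ∸ 1)) + newOcc 3 q (ascent π') r
  occFrom-123-insertMax r =
    trans (cong (λ L → sum³ L (occTerm p123 π r)) length-π)
    (trans (sum³-punchIn n q (occTerm p123 π r) 1≤q q≤)
    (trans (cong₂ _+_ maxFirst (cong₂ _+_ maxSecond (cong₂ _+_ (occTerm-123-max-last r) maxAvoided)))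
           (+-comm (newOcc 3 q (ascent π') r) _)))
    where
    maxFirst : sumBelow (suc n) (λ j → sumBelow (suc n) (λ k → occTerm p123 π r q (suc j) (suc k))) ≡ 0
    maxFirst = sumBelow-zero (suc n) _ λ j _ → sumBelow-zero (suc n) _ λ k _ →
      max-not-first 1 2 3 orderIso-123-x≮y r (suc j) (suc k)
    maxSecond : sumBelow n (λ i → sumBelow (suc n) (λ k → occTerm p123 π r (punchIn q (suc i)) q (suc k))) ≡ 0
    maxSecond = sumBelow-zero n _ λ i _ → sumBelow-zero (suc n) _ λ k _ →
      max-not-second-123 r (punchIn q (suc i)) (suc k)
    maxAvoided : sum³ n (λ i j k → occTerm p123 π r (punchIn q i) (punchIn q j) (punchIn q k))
               ≡ occFrom p123 π' (q ⊔ (r ∸ 1))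
    maxAvoided = occTerm-avoiding-max 1 2 3 r λ i j k →
      maxOutsideShading-123 n q i j k (at π' i) (at π' j) (at π' k) 1≤q q≤ (P'.at≤ i) (P'.at≤ j) (P'.at≤ k)

  occFrom-132-insertMax : ∀ r → occFrom p132 π r ≡ occFrom p132 π' (q ⊔ (r ∸ 1)) + newOcc 2 q (ascent π') r
  occFrom-132-insertMax r =
    trans (cong (λ L → sum³ L (occTerm p132 π r)) length-π)
    (trans (sum³-punchIn n q (occTerm p132 π r) 1≤q q≤)
    (trans (cong₂ _+_ maxFirst (cong₂ _+_ (occTerm-132-max-middle r) (cong₂ _+_ maxLast maxAvoided)))
           (trans (cong (newOcc 2 q (ascent π') r +_) (+-identityˡ _))
                  (+-comm (newOcc 2 q (ascent π') r) _))))
    where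
    maxFirst : sumBelow (suc n) (λ j → sumBelow (suc n) (λ k → occTerm p132 π r q (suc j) (suc k))) ≡ 0
    maxFirst = sumBelow-zero (suc n) _ λ j _ → sumBelow-zero (suc n) _ λ k _ →
      max-not-first 1 3 2 orderIso-132-x≮y r (suc j) (suc k)
    maxLast : sumBelow n (λ i → sumBelow n (λ j → occTerm p132 π r (punchIn q (suc i)) (punchIn q (suc j)) q))
            ≡ 0
    maxLast = sumBelow-zero n _ λ i _ → sumBelow-zero n _ λ j _ →
      max-not-last-132 r (punchIn q (suc i)) (punchIn q (suc j))
    maxAvoided : sum³ n (λ i j k → occTerm p132 π r (punchIn q i) (punchIn q j) (punchIn q k))
               ≡ occFrom p132 π' (q ⊔ (r ∸ 1))
    maxAvoided = occTerm-avoiding-max 1 3 2 r λ i j k →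
      maxOutsideShading-132 n q i j k (at π' i) (at π' j) (at π' k) 1≤q q≤ (P'.at≤ i) (P'.at≤ j) (P'.at≤ k)

occFrom-123-insertMax : ∀ {n π'} q → Perm n π' → 1 ≤ q → q ≤ suc n → ∀ r →
  occFrom p123 (insertAt π' q (suc n)) r ≡ occFrom p123 π' (q ⊔ (r ∸ 1)) + newOcc 3 q (ascent π') r
occFrom-123-insertMax q P@record { length≡ = refl } 1≤q q≤ = InsertMax.occFrom-123-insertMax _ P q 1≤q q≤

occFrom-132-insertMax : ∀ {n π'} q → Perm n π' → 1 ≤ q → q ≤ suc n → ∀ r →
  occFrom p132 (insertAt π' q (suc n)) r ≡ occFrom p132 π' (q ⊔ (r ∸ 1)) + newOcc 2 q (ascent π') r
occFrom-132-insertMax q P@record { length≡ = refl } 1≤q q≤ = InsertMax.occFrom-132-insertMax _ P q 1≤q q≤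

-- Every occurrence ends at a position k ≥ 3, so thresholds r ≤ 3 are vacuous.
occFrom-≤3 : ∀ p π r → r ≤ 3 → occFrom p π r ≡ occFrom p π 0
occFrom-≤3 p π r r≤3 = sumBelow-cong n λ i _ → sumBelow-cong n λ j _ → sumBelow-cong n λ k _ → vacuous i j k
  where
  n : ℕ
  n = length π
  vacuous : ∀ i j k → occTerm p π r (suc i) (suc j) (suc k) ≡ occTerm p π 0 (suc i) (suc j) (suc k)
  vacuous i j k with i <? j | j <? k
  ... | no i≮j  | _       rewrite ≥⇒<ᵇ≡false (≮⇒≥ i≮j) = refl
  ... | yes i<j | no j≮k  rewrite <⇒<ᵇ≡true i<j | ≥⇒<ᵇ≡false (≮⇒≥ j≮k) = refl
  ... | yes i<j | yes j<k
    rewrite <⇒<ᵇ≡true i<j | <⇒<ᵇ≡true j<k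
          | ≥⇒<ᵇ≡false {suc k} {r} (≤-trans r≤3 (s≤s (≤-trans (s≤s (s≤s z≤n)) (<-≤-trans (s≤s i<j) j<k)))) = refl

-- The involution φ

swap23 : Bool → ℕ → ℕ
swap23 true 2 = 3
swap23 true 3 = 2
swap23 _    q = q

swap23-involutive : ∀ b q → swap23 b (swap23 b q) ≡ q
swap23-involutive false q                           = refl
swap23-involutive true  0                           = refl
swap23-involutive true  1                           = refl
swap23-involutive true  2                           = refl
swap23-involutive true  3                           = refl
swap23-involutive true  (suc (suc (suc (suc q)))) = refl

swap23-range : ∀ b q n → (b ≡ true → 2 ≤ n) → 1 ≤ q → q ≤ suc n → 1 ≤ swap23 b q × swap23 b q ≤ suc n
swap23-range false q                         n _   1≤q q≤ = 1≤q , q≤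
swap23-range true  1                         n _   1≤q q≤ = 1≤q , q≤
swap23-range true  2                         n 2≤n _   _  = s≤s z≤n , s≤s (2≤n refl)
swap23-range true  3                         n _   _   q≤ = s≤s z≤n , ≤-trans (s≤s (s≤s z≤n)) q≤
swap23-range true  (suc (suc (suc (suc q)))) n _   1≤q q≤ = 1≤q , q≤

ascentAfterInsert : ℕ → Bool → Bool
ascentAfterInsert 0                   _ = false
ascentAfterInsert 1                   _ = false
ascentAfterInsert 2                   _ = true
ascentAfterInsert (suc (suc (suc _))) b = b

ascent-insertAt : ∀ ρ q v → (∀ m → at ρ m < v) → 1 ≤ q → q ≤ suc (length ρ) →
  ascent (insertAt ρ q v) ≡ ascentAfterInsert q (ascent ρ)
ascent-insertAt ρ           1                   v below _ _ = ≥⇒<ᵇ≡false (<⇒≤ (below 1))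
ascent-insertAt []          2                   v below _ (s≤s ())
ascent-insertAt (x ∷ ρ)     2                   v below _ _ = <⇒<ᵇ≡true (below 1)
ascent-insertAt (x ∷ [])    (suc (suc (suc q))) v below _ (s≤s (s≤s ()))
ascent-insertAt (x ∷ y ∷ ρ) (suc (suc (suc q))) v below _ _ = refl

ascentAfterInsert-swap23 : ∀ b q → ascentAfterInsert (swap23 b q) b ≡ ascentAfterInsert q b
ascentAfterInsert-swap23 false q                         = refl
ascentAfterInsert-swap23 true  0                         = refl
ascentAfterInsert-swap23 true  1                         = refl
ascentAfterInsert-swap23 true  2                         = refl
ascentAfterInsert-swap23 true  3                         = refl
ascentAfterInsert-swap23 true  (suc (suc (suc (suc q)))) = refl

ascent⇒2≤length : ∀ ρ → ascent ρ ≡ true → 2 ≤ length ρ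
ascent⇒2≤length ρ asc with 2 ≤? length ρ
... | yes 2≤ = 2≤
... | no 2≰ = ⊥-elim (n≮0 (<ᵇ≡true⇒< {at ρ 1} {0} (subst (λ v → (at ρ 1 <ᵇ v) ≡ true) (at-beyond ρ 2 (≰⇒> 2≰)) asc)))

φ : ℕ → List ℕ → List ℕ
φ zero    π = π
φ (suc n) π = insertAt ρ (swap23 (ascent ρ) (suc (indexOf (suc n) π))) (suc n)
  where
  ρ : List ℕ
  ρ = φ n (remove (suc n) π)

φ-insertMax : ∀ {n ρ} q → Perm n ρ → 1 ≤ q → q ≤ suc n →
  φ (suc n) (insertAt ρ q (suc n)) ≡ insertAt (φ n ρ) (swap23 (ascent (φ n ρ)) q) (suc n)
φ-insertMax {n} {ρ} q P 1≤q q≤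
  rewrite remove-insertAt (suc n) ρ q (Perm.count-above-max P) 1≤q (Perm.position≤ P q≤)
        | indexOf-insertAt (suc n) ρ q (Perm.count-above-max P) 1≤q (Perm.position≤ P q≤) = refl

⊔-2≗⊔-3 : ∀ (B : ℕ → ℕ) → (∀ s → s ≤ 3 → B s ≡ B 0) → ∀ t → B (2 ⊔ t) ≡ B (3 ⊔ t)
⊔-2≗⊔-3 B vacuous t with t ≤? 3
... | yes t≤3 = trans (vacuous (2 ⊔ t) (⊔-lub (s≤s (s≤s z≤n)) t≤3)) (sym (vacuous (3 ⊔ t) (⊔-lub ≤-refl t≤3)))
... | no t≰3  = cong B (trans (m≤n⇒m⊔n≡n (≤-trans (n≤1+n 2) 3≤t)) (sym (m≤n⇒m⊔n≡n 3≤t)))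
  where
  3≤t : 3 ≤ t
  3≤t = <⇒≤ (≰⇒> t≰3)

-- The new occurrence created by the maximum sits at position 3 for 123 and at
-- position 2 for 132; the exchange 2 ↔ 3 is invisible to older occurrences.
swap23-step : ∀ q b r t (A B : ℕ → ℕ) → (∀ s → A s ≡ B s) → (∀ s → s ≤ 3 → B s ≡ B 0) →
  A (q ⊔ t) + newOcc 3 q b r ≡ B (swap23 b q ⊔ t) + newOcc 2 (swap23 b q) b r
swap23-step q false r t A B A≗B _ rewrite ∧-zeroʳ (q ≡ᵇ 3) | ∧-zeroʳ (q ≡ᵇ 2) = cong (_+ 0) (A≗B (q ⊔ t))
swap23-step 0 true r t A B A≗B _       = cong (_+ 0) (A≗B (0 ⊔ t))
swap23-step 1 true r t A B A≗B _       = cong (_+ 0) (A≗B (1 ⊔ t))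
swap23-step 2 true r t A B A≗B vacuous = cong (_+ 0) (trans (A≗B (2 ⊔ t)) (⊔-2≗⊔-3 B vacuous t))
swap23-step 3 true r t A B A≗B vacuous = cong (_+ newOcc 3 3 true r) (trans (A≗B (3 ⊔ t)) (sym (⊔-2≗⊔-3 B vacuous t)))
swap23-step (suc (suc (suc (suc q)))) true r t A B A≗B _ = cong (_+ 0) (A≗B (suc (suc (suc (suc q))) ⊔ t))

record φ-Spec (n : ℕ) (π : List ℕ) : Set where
  field
    perm       : Perm n (φ n π)
    involutive : φ n (φ n π) ≡ π
    ascent-φ   : ascent (φ n π) ≡ ascent π
    occFrom-φ  : ∀ r → occFrom p123 π r ≡ occFrom p132 (φ n π) r

module φ-Step {n π} (P : Perm (suc n) π) (IH : φ-Spec n (remove (suc n) π)) where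
  private
    module IH = φ-Spec IH

  π' ρ : List ℕ
  π' = remove (suc n) π
  ρ  = φ n π'

  b : Bool
  b = ascent ρ

  q q* : ℕ
  q  = suc (indexOf (suc n) π)
  q* = swap23 b q

  P' : Perm n π'
  P' = Perm-removeMax P

  Pρ : Perm n ρ
  Pρ = IH.perm

  private
    module P' = Perm P'
    module Pρ = Perm Pρ

  π≡ : π ≡ insertAt π' q (suc n)
  π≡ = sym (insertAt-remove (suc n) π (max∈ P))

  q≤ : q ≤ suc n
  q≤ = maxPosition≤ P

  1≤q* : 1 ≤ q*
  1≤q* = proj₁ (swap23-range b q n (λ asc → subst (2 ≤_) Pρ.length≡ (ascent⇒2≤length ρ asc)) (s≤s z≤n) q≤)

  q*≤ : q* ≤ suc n
  q*≤ = proj₂ (swap23-range b q n (λ asc → subst (2 ≤_) Pρ.length≡ (ascent⇒2≤length ρ asc)) (s≤s z≤n) q≤)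

  perm : Perm (suc n) (insertAt ρ q* (suc n))
  perm = Perm-insertMax q* Pρ 1≤q* q*≤

  involutive : φ (suc n) (insertAt ρ q* (suc n)) ≡ π
  involutive = begin
    φ (suc n) (insertAt ρ q* (suc n))
      ≡⟨ φ-insertMax q* Pρ 1≤q* q*≤ ⟩
    insertAt (φ n ρ) (swap23 (ascent (φ n ρ)) q*) (suc n)
      ≡⟨ cong (λ σ → insertAt σ (swap23 (ascent σ) q*) (suc n)) IH.involutive ⟩
    insertAt π' (swap23 (ascent π') q*) (suc n)
      ≡⟨ cong (λ c → insertAt π' (swap23 c q*) (suc n)) (sym IH.ascent-φ) ⟩
    insertAt π' (swap23 b q*) (suc n)
      ≡⟨ cong (λ p → insertAt π' p (suc n)) (swap23-involutive b q) ⟩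
    insertAt π' q (suc n)
      ≡⟨ π≡ ⟨
    π ∎
    where open ≡-Reasoning

  ascent-φ : ascent (insertAt ρ q* (suc n)) ≡ ascent π
  ascent-φ = begin
    ascent (insertAt ρ q* (suc n))  ≡⟨ ascent-insertAt ρ q* (suc n) (s≤s ∘ Pρ.at≤) 1≤q* (Pρ.position≤ q*≤) ⟩
    ascentAfterInsert q* b          ≡⟨ ascentAfterInsert-swap23 b q ⟩
    ascentAfterInsert q b           ≡⟨ cong (ascentAfterInsert q) IH.ascent-φ ⟩
    ascentAfterInsert q (ascent π') ≡⟨ ascent-insertAt π' q (suc n) (s≤s ∘ P'.at≤) (s≤s z≤n) (P'.position≤ q≤) ⟨
    ascent (insertAt π' q (suc n))  ≡⟨ cong ascent π≡ ⟨
    ascent π                        ∎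
    where open ≡-Reasoning

  occFrom-φ : ∀ r → occFrom p123 π r ≡ occFrom p132 (insertAt ρ q* (suc n)) r
  occFrom-φ r = begin
    occFrom p123 π r
      ≡⟨ cong (λ σ → occFrom p123 σ r) π≡ ⟩
    occFrom p123 (insertAt π' q (suc n)) r
      ≡⟨ occFrom-123-insertMax q P' (s≤s z≤n) q≤ r ⟩
    occFrom p123 π' (q ⊔ (r ∸ 1)) + newOcc 3 q (ascent π') r
      ≡⟨ cong (λ c → occFrom p123 π' (q ⊔ (r ∸ 1)) + newOcc 3 q c r) (sym IH.ascent-φ) ⟩
    occFrom p123 π' (q ⊔ (r ∸ 1)) + newOcc 3 q b r
      ≡⟨ swap23-step q b r (r ∸ 1) (occFrom p123 π') (occFrom p132 ρ) IH.occFrom-φ (occFrom-≤3 p132 ρ) ⟩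
    occFrom p132 ρ (q* ⊔ (r ∸ 1)) + newOcc 2 q* b r
      ≡⟨ occFrom-132-insertMax q* Pρ 1≤q* q*≤ r ⟨
    occFrom p132 (insertAt ρ q* (suc n)) r ∎
    where open ≡-Reasoning

φ-spec : ∀ n π → Perm n π → φ-Spec n π
φ-spec zero    []      P = record { perm = P ; involutive = refl ; ascent-φ = refl ; occFrom-φ = λ r → refl }
φ-spec zero    (_ ∷ _) P with () ← Perm.length≡ P
φ-spec (suc n) π       P = record
  { perm = perm ; involutive = involutive ; ascent-φ = ascent-φ ; occFrom-φ = occFrom-φ }
  where open φ-Step P (φ-spec n (remove (suc n) π) (Perm-removeMax P))

-- Counting over S_n

extendWord : ℕ → List ℕ → List (List ℕ)
extendWord k w = map (λ v → suc v ∷ w) (upTo k)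

∈-words⁻ : ∀ m k w → w ∈ words m k → length w ≡ m × All (λ v → 1 ≤ v × v ≤ k) w
∈-words⁻ zero    k .[] (here refl) = refl , []
∈-words⁻ (suc m) k w   w∈
  with w' , w'∈ , w∈ext ← find (∈-concatMap⁻ (extendWord k) {xs = words m k} w∈)
  with v , v∈ , refl ← ∈-map⁻ (λ v → suc v ∷ w') w∈ext
  with length≡m , inRange ← ∈-words⁻ m k w' w'∈ = cong suc length≡m , (s≤s z≤n , ∈-upTo⁻ v∈) ∷ inRange

∈-words⁺ : ∀ m k w → length w ≡ m → All (λ v → 1 ≤ v × v ≤ k) w → w ∈ words m k
∈-words⁺ zero    k []          refl [] = here refl
∈-words⁺ (suc m) k (suc v ∷ w) refl ((_ , v<k) ∷ all) =
  ∈-concatMap⁺ (extendWord k) {xs = words m k}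
    (lose (∈-words⁺ m k w refl all) (∈-map⁺ (λ v → suc v ∷ w) (∈-upTo⁺ v<k)))

words-unique : ∀ m k → Unique (words m k)
words-unique zero    k = [] AllPairs.∷ AllPairs.[]
words-unique (suc m) k =
  UniqueP.concat⁺
    (AllP.map⁺ (All.universal (λ w → UniqueP.map⁺ (suc-injective ∘ ∷-injectiveˡ) (UniqueP.upTo⁺ k)) (words m k)))
                  (AllPairsP.map⁺ (AllPairs.map disjoint (words-unique m k)))
  where
  disjoint : ∀ {w w'} → w ≢ w' → Disjoint (extendWord k w) (extendWord k w')
  disjoint w≢w' (v∈ , v∈') with ∈-map⁻ _ v∈ | ∈-map⁻ _ v∈'
  ... | _ , _ , refl | _ , _ , e = w≢w' (∷-injectiveʳ e)

∈-Sym⁻ : ∀ n π → π ∈ Sym n → Perm n π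
∈-Sym⁻ n π π∈ with w∈ , isPerm ← ∈-filter⁻ (λ w → T? (isPerm n w)) {xs = words n n} π∈ = record
  { length≡     = proj₁ (∈-words⁻ n n π w∈)
  ; inRange     = proj₂ (∈-words⁻ n n π w∈)
  ; isPerm≡true = Equivalence.to T-≡ isPerm
  }

∈-Sym⁺ : ∀ n π → Perm n π → π ∈ Sym n
∈-Sym⁺ n π P = ∈-filter⁺ (λ w → T? (isPerm n w)) {xs = words n n}
  (∈-words⁺ n n π (Perm.length≡ P) (Perm.inRange P)) (Equivalence.from T-≡ (Perm.isPerm≡true P))

Sym-unique : ∀ n → Unique (Sym n)
Sym-unique n = UniqueP.filter⁺ (λ w → T? (isPerm n w)) (words-unique n n)

Unique-map⁺ : {A B : Set} (f : A → B) (xs : List A) → Unique xs →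
  (∀ {x y} → x ∈ xs → y ∈ xs → f x ≡ f y → x ≡ y) → Unique (map f xs)
Unique-map⁺ f []       _                       _   = AllPairs.[]
Unique-map⁺ f (x ∷ xs) (x∉xs AllPairs.∷ xs!) inj =
  AllP.map⁺ (All.tabulate (λ y∈ fx≡fy → All.lookup x∉xs y∈ (inj (here refl) (there y∈) fx≡fy)))
  AllPairs.∷ Unique-map⁺ f xs xs! (λ x∈ y∈ → inj (there x∈) (there y∈))

map-involution-↭ : {A : Set} (f : A → A) (xs : List A) → Unique xs →
  (∀ {x} → x ∈ xs → f x ∈ xs) → (∀ {x} → x ∈ xs → f (f x) ≡ x) → map f xs ↭ xs
map-involution-↭ f xs xs! closed involutive =
  ∼bag⇒↭ (unique∧set⇒bag (Unique-map⁺ f xs xs! injective) xs! (mk⇔ to from))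
  where
  injective : ∀ {x y} → x ∈ xs → y ∈ xs → f x ≡ f y → x ≡ y
  injective x∈ y∈ fx≡fy = trans (sym (involutive x∈)) (trans (cong f fx≡fy) (involutive y∈))
  to : ∀ {x} → x ∈ map f xs → x ∈ xs
  to x∈ with y , y∈ , refl ← ∈-map⁻ f x∈ = closed y∈
  from : ∀ {x} → x ∈ xs → x ∈ map f xs
  from x∈ = subst (_∈ map f xs) (involutive x∈) (∈-map⁺ f (closed x∈))

theorem3p4 : mesh 1 2 3 R₀ ∼d mesh 1 3 2 R₀
theorem3p4 n ℓ = begin
  countᵇ (hasℓ p123) (Sym n)             ≡⟨ countᵇ-cong∈ _ _ (Sym n) (λ π∈ → cong (_≡ᵇ ℓ) (occ-φ π∈)) ⟩
  countᵇ (hasℓ p132 ∘ φ n) (Sym n)       ≡⟨ countᵇ-map (hasℓ p132) (φ n) (Sym n) ⟨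
  countᵇ (hasℓ p132) (map (φ n) (Sym n)) ≡⟨ countᵇ-↭ (hasℓ p132) φ-permutes ⟩
  countᵇ (hasℓ p132) (Sym n)             ∎
  where
  open ≡-Reasoning
  hasℓ : MeshPattern3 → List ℕ → Bool
  hasℓ p π = occ p π ≡ᵇ ℓ
  spec : ∀ {π} → π ∈ Sym n → φ-Spec n π
  spec {π} π∈ = φ-spec n π (∈-Sym⁻ n π π∈)
  occ-φ : ∀ {π} → π ∈ Sym n → occ p123 π ≡ occ p132 (φ n π)
  occ-φ {π} π∈ =
    trans (occ≡occFrom0 p123 π) (trans (φ-Spec.occFrom-φ (spec π∈) 0) (sym (occ≡occFrom0 p132 (φ n π))))
  closed : ∀ {π} → π ∈ Sym n → φ n π ∈ Sym n
  closed {π} π∈ = ∈-Sym⁺ n (φ n π) (φ-Spec.perm (spec π∈))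
  involutive : ∀ {π} → π ∈ Sym n → φ n (φ n π) ≡ π
  involutive π∈ = φ-Spec.involutive (spec π∈)
  φ-permutes : map (φ n) (Sym n) ↭ Sym n
  φ-permutes = map-involution-↭ (φ n) (Sym n) (Sym-unique n) closed involutive
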